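{- For $n\ge 4$ let $\mathbf{2314}_n$ be the total number of consecutive occurrences of the pattern $2314$ summed over all permutations in $\mathrm{Av}_n(123,132)$, and let $|\mathcal I_m|$ denote the number of involutions of $\{1,\dots,m\}$. Then $\mathbf{2314}_4=1$, $\mathbf{2314}_5=4$, and for all $n\ge6$, $$\mathbf{2314}_n=\mathbf{2314}_{n-1}+(n-1)\,\mathbf{2314}_{n-2}+\binom{n-2}{2}|\mathcal I_{n-4}|.$$
   Context: A permutation $\pi=a_1\dots a_n$ contains a consecutive occurrence of a pattern $p\in\mathcal S_r$ at position $i$ if $a_i\dots a_{i+r-1}$ is order-isomorphic to $p$; $\mathrm{Av}_n(p_1,\dots,p_k)$ is the set of permutations of size $n$ with no consecutive occurrence of any $p_j$. -}

module Defs where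

open import Data.Nat using (ℕ; zero; suc; _+_; _*_; _<_; _<ᵇ_)
open import Data.Bool using (Bool; true; false; _∧_; _∨_; not; if_then_else_)
open import Data.List using (List; []; _∷_; map; concatMap; length; filter; upTo; take; drop)
open import Data.Nat.ListAction using (sum)
open import Data.Nat using (_≡ᵇ_)

-- A permutation of size n is represented as its one-line notation
-- a₁ … aₙ, a list of length n of values in {0,…,n-1} with no repetition
-- (values shifted by one from {1,…,n}; irrelevant for order-isomorphism).

words : ℕ → ℕ → List (List ℕ)
words m zero = [] ∷ []
words m (suc k) = concatMap (λ a → map (a ∷_) (words m k)) (upTo m)

elemᵇ : ℕ → List ℕ → Bool
elemᵇ x [] = false
elemᵇ x (y ∷ ys) = (x ≡ᵇ y) ∨ elemᵇ x ys

distinctᵇ : List ℕ → Bool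
distinctᵇ [] = true
distinctᵇ (x ∷ xs) = not (elemᵇ x xs) ∧ distinctᵇ xs

perms : ℕ → List (List ℕ)
perms n = filter (λ w → distinctᵇ w Data.Bool.≟ true) (words n n)
  where import Data.Bool

ltPattern : List ℕ → List (List Bool)
ltPattern xs = map (λ x → map (λ y → x <ᵇ y) xs) xs

eqBools : List Bool → List Bool → Bool
eqBools [] [] = true
eqBools (a ∷ as) (b ∷ bs) = (if a then b else not b) ∧ eqBools as bs
eqBools _ _ = false

eqBoolss : List (List Bool) → List (List Bool) → Bool
eqBoolss [] [] = true
eqBoolss (a ∷ as) (b ∷ bs) = eqBools a b ∧ eqBoolss as bs
eqBoolss _ _ = false

orderIso : List ℕ → List ℕ → Bool
orderIso xs ys = eqBoolss (ltPattern xs) (ltPattern ys)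

occ : List ℕ → List ℕ → ℕ
occ p [] = 0
occ p (x ∷ xs) =
  (if orderIso p (take (length p) (x ∷ xs)) ∧ (length p ≡ᵇ length (take (length p) (x ∷ xs)))
   then 1 else 0) + occ p xs

containsᵇ : List ℕ → List ℕ → Bool
containsᵇ p w = not (occ p w ≡ᵇ 0)

p123 p132 p2314 : List ℕ
p123 = 0 ∷ 1 ∷ 2 ∷ []
p132 = 0 ∷ 2 ∷ 1 ∷ []
p2314 = 1 ∷ 2 ∷ 0 ∷ 3 ∷ []

av123-132 : ℕ → List (List ℕ)
av123-132 n = filter (λ w → (not (containsᵇ p123 w ∨ containsᵇ p132 w)) Data.Bool.≟ true) (perms n)
  where import Data.Bool

count2314 : ℕ → ℕ
count2314 n = sum (map (occ p2314) (av123-132 n))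

lookupℕ : List ℕ → ℕ → ℕ
lookupℕ [] i = 0
lookupℕ (x ∷ xs) zero = x
lookupℕ (x ∷ xs) (suc i) = lookupℕ xs i

allᵇ : (ℕ → Bool) → List ℕ → Bool
allᵇ f [] = true
allᵇ f (x ∷ xs) = f x ∧ allᵇ f xs

isInvolutionᵇ : List ℕ → Bool
isInvolutionᵇ w = allᵇ (λ i → lookupℕ w (lookupℕ w i) ≡ᵇ i) (upTo (length w))

numInvolutions : ℕ → ℕ
numInvolutions m = length (filter (λ w → isInvolutionᵇ w Data.Bool.≟ true) (perms m))
  where import Data.Bool

-- The minimum of a permutation avoiding consecutive 123 and 132 is its last or second-to-last
-- entry, since two entries after it would form a 123 or a 132. Deleting it (in the second case
-- together with the entry y following it) and standardising gives a bijection
--   Av_n ≅ Av_{n-1} ⊎ ({1, …, n-1} × Av_{n-2}),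
-- so |Av_n| satisfies the involution recurrence |I_n| = |I_{n-1}| + (n-1) |I_{n-2}| and equals |I_n|.
-- The deletion keeps every occurrence of 2314 except b c 0 y, which occurs exactly when the two
-- entries b c before the minimum satisfy b < c < y. After the deletion, b c end a permutation in
-- Av_{n-2}, so by the same dichotomy b c = 0 (y′+1) up to standardisation, with the rest in
-- Av_{n-4}; this leaves n-3-y′ choices of y, and summing over y′ gives C(n-2, 2) |Av_{n-4}|.
-- Everything is counted by sums over all words of length n over {0, …, n-1}, weighted by an
-- indicator of being a permutation in Av_n; the bijections become reindexings of these sums,
-- obtained by deleting letters from the alphabet.
module Submission where

open import Defs
open import Data.Bool using (Bool; true; false; T; _∧_; _∨_; not; if_then_else_)
import Data.Bool.Properties as Boolₚ
open import Data.Empty using (⊥-elim)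
open import Data.List using (List; []; _∷_; _++_; map; concatMap; length; filter; upTo; applyUpTo; take)
import Data.List.Properties as Listₚ
open import Data.List.Relation.Unary.All using (All; []; _∷_)
import Data.List.Relation.Unary.All.Properties as All
open import Data.Nat using (ℕ; zero; suc; _+_; _*_; _∸_; _≤_; _<_; _≥_; z≤n; s≤s; z<s; s<s; _≡ᵇ_; _<ᵇ_)
open import Data.Nat.Combinatorics using (_C_; nC1≡n; nCk+nC[k+1]≡[n+1]C[k+1])
open import Data.Nat.ListAction using (sum)
open import Data.Nat.Properties
open import Data.Product using (_×_; _,_; proj₁; proj₂; ∃-syntax)
open import Data.Sum using (_⊎_; inj₁; inj₂)
open import Function using (_∘_; id; case_of_)
open import Function.Bundles using (Equivalence; mk⇔)
open import Relation.Binary.Definitions using (tri<; tri≈; tri>)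
open import Relation.Binary.PropositionalEquality
open import Relation.Nullary using (yes; no)

private variable A B : Set

∑ : List A → (A → ℕ) → ℕ
∑ [] f = 0
∑ (x ∷ xs) f = f x + ∑ xs f

syntax ∑ xs (λ x → e) = ∑[ x ∈ xs ] e

sum-map≡∑ : (f : A → ℕ) (xs : List A) → sum (map f xs) ≡ ∑ xs f
sum-map≡∑ f [] = refl
sum-map≡∑ f (x ∷ xs) = cong (f x +_) (sum-map≡∑ f xs)

length≡∑1 : (xs : List A) → length xs ≡ ∑[ _ ∈ xs ] 1
length≡∑1 [] = refl
length≡∑1 (x ∷ xs) = cong suc (length≡∑1 xs)

∑-cong : (xs : List A) {f g : A → ℕ} → (∀ x → f x ≡ g x) → ∑ xs f ≡ ∑ xs g
∑-cong [] f≗g = refl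
∑-cong (x ∷ xs) f≗g = cong₂ _+_ (f≗g x) (∑-cong xs f≗g)

∑-zero : (xs : List A) → ∑[ _ ∈ xs ] 0 ≡ 0
∑-zero [] = refl
∑-zero (x ∷ xs) = ∑-zero xs

∑-const : (xs : List A) (c : ℕ) → ∑[ _ ∈ xs ] c ≡ length xs * c
∑-const [] c = refl
∑-const (x ∷ xs) c = cong (c +_) (∑-const xs c)

∑-if : (xs : List A) (b : Bool) (f : A → ℕ) →
       ∑[ x ∈ xs ] (if b then 0 else f x) ≡ (if b then 0 else ∑ xs f)
∑-if xs true f = ∑-zero xs
∑-if xs false f = refl

∑-+ : (xs : List A) (f g : A → ℕ) → ∑[ x ∈ xs ] (f x + g x) ≡ ∑ xs f + ∑ xs g
∑-+ [] f g = refl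
∑-+ (x ∷ xs) f g = begin
  f x + g x + ∑[ y ∈ xs ] (f y + g y) ≡⟨ cong (f x + g x +_) (∑-+ xs f g) ⟩
  f x + g x + (∑ xs f + ∑ xs g)      ≡⟨ +-assoc (f x) (g x) _ ⟩
  f x + (g x + (∑ xs f + ∑ xs g))    ≡⟨ cong (f x +_) (x+[y+z]≡y+[x+z] (g x) (∑ xs f) _) ⟩
  f x + (∑ xs f + (g x + ∑ xs g))    ≡⟨ +-assoc (f x) _ _ ⟨
  f x + ∑ xs f + (g x + ∑ xs g)      ∎
  where
  open ≡-Reasoning
  x+[y+z]≡y+[x+z] : ∀ a b c → a + (b + c) ≡ b + (a + c)
  x+[y+z]≡y+[x+z] a b c = trans (sym (+-assoc a b c)) (trans (cong (_+ c) (+-comm a b)) (+-assoc b a c))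

∑-*ˡ : (xs : List A) (c : ℕ) (f : A → ℕ) → ∑[ x ∈ xs ] (c * f x) ≡ c * ∑ xs f
∑-*ˡ [] c f = sym (*-zeroʳ c)
∑-*ˡ (x ∷ xs) c f = trans (cong (c * f x +_) (∑-*ˡ xs c f)) (sym (*-distribˡ-+ c (f x) (∑ xs f)))

∑-swap : (xs : List A) (ys : List B) (f : A → B → ℕ) →
         ∑[ x ∈ xs ] ∑[ y ∈ ys ] f x y ≡ ∑[ y ∈ ys ] ∑[ x ∈ xs ] f x y
∑-swap [] ys f = sym (∑-zero ys)
∑-swap (x ∷ xs) ys f =
  trans (cong (∑ ys (f x) +_) (∑-swap xs ys f)) (sym (∑-+ ys (f x) (λ y → ∑[ x ∈ xs ] f x y)))

∑-++ : (xs ys : List A) (f : A → ℕ) → ∑ (xs ++ ys) f ≡ ∑ xs f + ∑ ys f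
∑-++ [] ys f = refl
∑-++ (x ∷ xs) ys f = trans (cong (f x +_) (∑-++ xs ys f)) (sym (+-assoc (f x) _ _))

∑-map : (h : A → B) (xs : List A) (f : B → ℕ) → ∑ (map h xs) f ≡ ∑[ x ∈ xs ] f (h x)
∑-map h [] f = refl
∑-map h (x ∷ xs) f = cong (f (h x) +_) (∑-map h xs f)

∑-concatMap : (g : A → List B) (xs : List A) (f : B → ℕ) →
              ∑ (concatMap g xs) f ≡ ∑[ x ∈ xs ] ∑ (g x) f
∑-concatMap g [] f = refl
∑-concatMap g (x ∷ xs) f =
  trans (∑-++ (g x) (concatMap g xs) f) (cong (∑ (g x) f +_) (∑-concatMap g xs f))

∑-filter : (b : A → Bool) (xs : List A) (f : A → ℕ) →
           ∑ (filter (λ x → b x Boolₚ.≟ true) xs) f ≡ ∑[ x ∈ xs ] (if b x then f x else 0)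
∑-filter b [] f = refl
∑-filter b (x ∷ xs) f with b x
... | true = cong (f x +_) (∑-filter b xs f)
... | false = ∑-filter b xs f

∑-upTo-suc : ∀ n (f : ℕ → ℕ) → ∑ (upTo (suc n)) f ≡ f 0 + ∑[ i ∈ upTo n ] f (suc i)
∑-upTo-suc n f =
  cong (f 0 +_) (trans (cong (λ is → ∑ is f) (sym (Listₚ.map-upTo suc n))) (∑-map suc (upTo n) f))

∑-upTo-cong : ∀ n {f g : ℕ → ℕ} → (∀ i → i < n → f i ≡ g i) → ∑ (upTo n) f ≡ ∑ (upTo n) g
∑-upTo-cong zero f≗g = refl
∑-upTo-cong (suc n) {f} {g} f≗g = begin
  ∑ (upTo (suc n)) f               ≡⟨ ∑-upTo-suc n f ⟩
  f 0 + ∑[ i ∈ upTo n ] f (suc i)  ≡⟨ cong₂ _+_ (f≗g 0 z<s) (∑-upTo-cong n λ i i<n → f≗g (suc i) (s<s i<n)) ⟩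
  g 0 + ∑[ i ∈ upTo n ] g (suc i)  ≡⟨ ∑-upTo-suc n g ⟨
  ∑ (upTo (suc n)) g               ∎
  where open ≡-Reasoning

∑-upTo-const : ∀ n c → ∑[ _ ∈ upTo n ] c ≡ n * c
∑-upTo-const n c = trans (∑-const (upTo n) c) (cong (_* c) (Listₚ.length-upTo n))

<ᵇ≡true⇒< : ∀ m n → (m <ᵇ n) ≡ true → m < n
<ᵇ≡true⇒< m n m<ᵇn = <ᵇ⇒< m n (subst T (sym m<ᵇn) _)

<⇒<ᵇ≡true : ∀ m n → m < n → (m <ᵇ n) ≡ true
<⇒<ᵇ≡true m n m<n = Equivalence.to Boolₚ.T-≡ (<⇒<ᵇ m<n)

<ᵇ≡false⇒≥ : ∀ m n → (m <ᵇ n) ≡ false → n ≤ m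
<ᵇ≡false⇒≥ m n m≮ᵇn = ≮⇒≥ (λ m<n → subst T m≮ᵇn (<⇒<ᵇ m<n))

≥⇒<ᵇ≡false : ∀ m n → n ≤ m → (m <ᵇ n) ≡ false
≥⇒<ᵇ≡false m n n≤m with m <ᵇ n in m<ᵇn
... | true = ⊥-elim (≤⇒≯ n≤m (<ᵇ≡true⇒< m n m<ᵇn))
... | false = refl

<ᵇ-irrefl : ∀ n → (n <ᵇ n) ≡ false
<ᵇ-irrefl n = ≥⇒<ᵇ≡false n n ≤-refl

<ᵇ-asym : ∀ m n → (m <ᵇ n) ≡ true → (n <ᵇ m) ≡ false
<ᵇ-asym m n m<ᵇn = ≥⇒<ᵇ≡false n m (<⇒≤ (<ᵇ≡true⇒< m n m<ᵇn))

<ᵇ-trans : ∀ a b c → (a <ᵇ b) ≡ true → (b <ᵇ c) ≡ true → (a <ᵇ c) ≡ true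
<ᵇ-trans a b c a<ᵇb b<ᵇc = <⇒<ᵇ≡true a c (<-trans (<ᵇ≡true⇒< a b a<ᵇb) (<ᵇ≡true⇒< b c b<ᵇc))

≡ᵇ-refl : ∀ n → (n ≡ᵇ n) ≡ true
≡ᵇ-refl n = Equivalence.to Boolₚ.T-≡ (≡⇒≡ᵇ n n refl)

≡ᵇ-via-<ᵇ : ∀ m n → (m ≡ᵇ n) ≡ not (m <ᵇ n) ∧ not (n <ᵇ m)
≡ᵇ-via-<ᵇ zero zero = refl
≡ᵇ-via-<ᵇ zero (suc n) = refl
≡ᵇ-via-<ᵇ (suc m) zero = refl
≡ᵇ-via-<ᵇ (suc m) (suc n) = ≡ᵇ-via-<ᵇ m n

≡ᵇ-sym : ∀ m n → (m ≡ᵇ n) ≡ (n ≡ᵇ m)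
≡ᵇ-sym m n =
  trans (≡ᵇ-via-<ᵇ m n) (trans (Boolₚ.∧-comm (not (m <ᵇ n)) (not (n <ᵇ m))) (sym (≡ᵇ-via-<ᵇ n m)))

Word : Set
Word = List ℕ

remove : ℕ → List ℕ → List ℕ
remove x [] = []
remove x (a ∷ as) = if x ≡ᵇ a then remove x as else a ∷ remove x as

∑-remove : ∀ x as (f : ℕ → ℕ) → ∑[ a ∈ as ] (if x ≡ᵇ a then 0 else f a) ≡ ∑ (remove x as) f
∑-remove x [] f = refl
∑-remove x (a ∷ as) f with x ≡ᵇ a
... | true = ∑-remove x as f
... | false = cong (f a +_) (∑-remove x as f)

length-remove-≤ : ∀ x as → length (remove x as) ≤ length as
length-remove-≤ x [] = z≤n
length-remove-≤ x (a ∷ as) with x ≡ᵇ a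
... | true = m≤n⇒m≤1+n (length-remove-≤ x as)
... | false = s≤s (length-remove-≤ x as)

length-remove-< : ∀ x as → elemᵇ x as ≡ true → length (remove x as) < length as
length-remove-< x (a ∷ as) x∈as with x ≡ᵇ a
... | true = s≤s (length-remove-≤ x as)
... | false = s≤s (length-remove-< x as x∈as)

∑-cong-elemᵇ : ∀ as {f g : ℕ → ℕ} → (∀ a → elemᵇ a as ≡ true → f a ≡ g a) → ∑ as f ≡ ∑ as g
∑-cong-elemᵇ [] f≗g = refl
∑-cong-elemᵇ (x ∷ as) f≗g =
  cong₂ _+_ (f≗g x (cong (_∨ elemᵇ x as) (≡ᵇ-refl x)))
            (∑-cong-elemᵇ as λ a a∈as → f≗g a (trans (cong ((a ≡ᵇ x) ∨_) a∈as) (Boolₚ.∨-zeroʳ (a ≡ᵇ x))))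

wordsOver : List ℕ → ℕ → List Word
wordsOver as zero = [] ∷ []
wordsOver as (suc k) = concatMap (λ a → map (a ∷_) (wordsOver as k)) as

words≡wordsOver : ∀ m k → words m k ≡ wordsOver (upTo m) k
words≡wordsOver m zero = refl
words≡wordsOver m (suc k) = cong (λ ws → concatMap (λ a → map (a ∷_) ws) (upTo m)) (words≡wordsOver m k)

∑-wordsOver-suc : ∀ as k (f : Word → ℕ) →
  ∑ (wordsOver as (suc k)) f ≡ ∑[ a ∈ as ] ∑[ w ∈ wordsOver as k ] f (a ∷ w)
∑-wordsOver-suc as k f =
  trans (∑-concatMap _ as f) (∑-cong as (λ a → ∑-map (a ∷_) (wordsOver as k) f))

∑-wordsOver-∷ʳ : ∀ as k (f : Word → ℕ) →
  ∑ (wordsOver as (suc k)) f ≡ ∑[ w ∈ wordsOver as k ] ∑[ a ∈ as ] f (w ++ a ∷ [])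
∑-wordsOver-∷ʳ as zero f =
  trans (∑-wordsOver-suc as zero f) (trans (∑-cong as (λ a → +-identityʳ (f (a ∷ [])))) (sym (+-identityʳ _)))
∑-wordsOver-∷ʳ as (suc k) f = begin
  ∑ (wordsOver as (suc (suc k))) f
    ≡⟨ ∑-wordsOver-suc as (suc k) f ⟩
  ∑[ a ∈ as ] ∑[ w ∈ wordsOver as (suc k) ] f (a ∷ w)
    ≡⟨ ∑-cong as (λ a → ∑-wordsOver-∷ʳ as k (λ w → f (a ∷ w))) ⟩
  ∑[ a ∈ as ] ∑[ w ∈ wordsOver as k ] ∑[ b ∈ as ] f (a ∷ w ++ b ∷ [])
    ≡⟨ ∑-wordsOver-suc as k (λ w → ∑[ b ∈ as ] f (w ++ b ∷ [])) ⟨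
  ∑[ w ∈ wordsOver as (suc k) ] ∑[ b ∈ as ] f (w ++ b ∷ []) ∎
  where open ≡-Reasoning

∑-wordsOver-+ : ∀ as i j (f : Word → ℕ) →
  ∑ (wordsOver as (i + j)) f ≡ ∑[ u ∈ wordsOver as i ] ∑[ v ∈ wordsOver as j ] f (u ++ v)
∑-wordsOver-+ as zero j f = sym (+-identityʳ _)
∑-wordsOver-+ as (suc i) j f = begin
  ∑ (wordsOver as (suc i + j)) f
    ≡⟨ ∑-wordsOver-suc as (i + j) f ⟩
  ∑[ a ∈ as ] ∑[ w ∈ wordsOver as (i + j) ] f (a ∷ w)
    ≡⟨ ∑-cong as (λ a → ∑-wordsOver-+ as i j (λ w → f (a ∷ w))) ⟩
  ∑[ a ∈ as ] ∑[ u ∈ wordsOver as i ] ∑[ v ∈ wordsOver as j ] f (a ∷ u ++ v)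
    ≡⟨ ∑-wordsOver-suc as i (λ u → ∑[ v ∈ wordsOver as j ] f (u ++ v)) ⟨
  ∑[ u ∈ wordsOver as (suc i) ] ∑[ v ∈ wordsOver as j ] f (u ++ v) ∎
  where open ≡-Reasoning

∑-wordsOver-map : ∀ (h : ℕ → ℕ) as k (f : Word → ℕ) →
  ∑ (wordsOver (map h as) k) f ≡ ∑[ w ∈ wordsOver as k ] f (map h w)
∑-wordsOver-map h as zero f = refl
∑-wordsOver-map h as (suc k) f = begin
  ∑ (wordsOver (map h as) (suc k)) f
    ≡⟨ ∑-wordsOver-suc (map h as) k f ⟩
  ∑[ b ∈ map h as ] ∑[ w ∈ wordsOver (map h as) k ] f (b ∷ w)
    ≡⟨ ∑-map h as _ ⟩
  ∑[ a ∈ as ] ∑[ w ∈ wordsOver (map h as) k ] f (h a ∷ w)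
    ≡⟨ ∑-cong as (λ a → ∑-wordsOver-map h as k (λ w → f (h a ∷ w))) ⟩
  ∑[ a ∈ as ] ∑[ w ∈ wordsOver as k ] f (h a ∷ map h w)
    ≡⟨ ∑-wordsOver-suc as k (λ w → f (map h w)) ⟨
  ∑[ w ∈ wordsOver as (suc k) ] f (map h w) ∎
  where open ≡-Reasoning

∑-wordsOver-remove : ∀ x as k (f : Word → ℕ) →
  ∑[ w ∈ wordsOver as k ] (if elemᵇ x w then 0 else f w) ≡ ∑ (wordsOver (remove x as) k) f
∑-wordsOver-remove x as zero f = refl
∑-wordsOver-remove x as (suc k) f =
  trans (∑-wordsOver-suc as k _)
  (trans (∑-cong as firstLetter)
  (trans (∑-remove x as _)
         (sym (∑-wordsOver-suc (remove x as) k f))))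
  where
  firstLetter : ∀ a → ∑[ w ∈ wordsOver as k ] (if (x ≡ᵇ a) ∨ elemᵇ x w then 0 else f (a ∷ w))
                    ≡ (if x ≡ᵇ a then 0 else ∑[ w ∈ wordsOver (remove x as) k ] f (a ∷ w))
  firstLetter a with x ≡ᵇ a
  ... | true = ∑-zero (wordsOver as k)
  ... | false = ∑-wordsOver-remove x as k (λ w → f (a ∷ w))

∑-wordsOver-pigeonhole : ∀ k as (f : Word → ℕ) → length as < k →
  ∑[ w ∈ wordsOver as k ] (if distinctᵇ w then f w else 0) ≡ 0
∑-wordsOver-pigeonhole (suc k) as f (s≤s |as|≤k) =
  trans (∑-wordsOver-suc as k _) (trans (∑-cong-elemᵇ as firstLetter) (∑-zero as))
  where
  firstLetter : ∀ a → elemᵇ a as ≡ true →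
    ∑[ w ∈ wordsOver as k ] (if not (elemᵇ a w) ∧ distinctᵇ w then f (a ∷ w) else 0) ≡ 0
  firstLetter a a∈as =
    trans (∑-cong (wordsOver as k) reorder)
    (trans (∑-wordsOver-remove a as k _)
           (∑-wordsOver-pigeonhole k (remove a as) _ (≤-trans (length-remove-< a as a∈as) |as|≤k)))
    where
    reorder : ∀ w → (if not (elemᵇ a w) ∧ distinctᵇ w then f (a ∷ w) else 0)
                  ≡ (if elemᵇ a w then 0 else (if distinctᵇ w then f (a ∷ w) else 0))
    reorder w with elemᵇ a w
    ... | true = refl
    ... | false = refl

∑-wordsOver-upTo-cong : ∀ n k {f g : Word → ℕ} →
  (∀ w → All (_< n) w → length w ≡ k → f w ≡ g w) →
  ∑ (wordsOver (upTo n) k) f ≡ ∑ (wordsOver (upTo n) k) g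
∑-wordsOver-upTo-cong n zero f≗g = cong (_+ 0) (f≗g [] [] refl)
∑-wordsOver-upTo-cong n (suc k) {f} {g} f≗g =
  trans (∑-wordsOver-suc (upTo n) k f)
  (trans (∑-upTo-cong n λ a a<n →
           ∑-wordsOver-upTo-cong n k λ w w<n |w| → f≗g (a ∷ w) (a<n ∷ w<n) (cong suc |w|))
         (sym (∑-wordsOver-suc (upTo n) k g)))

elemᵇ-++ : ∀ x xs ys → elemᵇ x (xs ++ ys) ≡ elemᵇ x xs ∨ elemᵇ x ys
elemᵇ-++ x [] ys = refl
elemᵇ-++ x (a ∷ xs) ys rewrite elemᵇ-++ x xs ys = sym (Boolₚ.∨-assoc (x ≡ᵇ a) (elemᵇ x xs) (elemᵇ x ys))

elemᵇ-0-map-suc : ∀ xs → elemᵇ 0 (map suc xs) ≡ false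
elemᵇ-0-map-suc [] = refl
elemᵇ-0-map-suc (x ∷ xs) = elemᵇ-0-map-suc xs

distinctᵇ-middle : ∀ xs y ys →
  distinctᵇ (xs ++ y ∷ ys) ≡ not (elemᵇ y xs ∨ elemᵇ y ys) ∧ distinctᵇ (xs ++ ys)
distinctᵇ-middle [] y ys = refl
distinctᵇ-middle (x ∷ xs) y ys
  rewrite distinctᵇ-middle xs y ys | elemᵇ-++ x xs (y ∷ ys) | elemᵇ-++ x xs ys | ≡ᵇ-sym x y =
  shuffle (elemᵇ x xs) (y ≡ᵇ x) (elemᵇ x ys) (elemᵇ y xs) (elemᵇ y ys) (distinctᵇ (xs ++ ys))
  where
  shuffle : ∀ a b c d e f →
            not (a ∨ (b ∨ c)) ∧ (not (d ∨ e) ∧ f) ≡ not ((b ∨ d) ∨ e) ∧ (not (a ∨ c) ∧ f)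
  shuffle true b c d e f with b ∨ d
  ... | true = refl
  ... | false with e
  ...   | true = refl
  ...   | false = refl
  shuffle false true c d e f = refl
  shuffle false false true d e f with d ∨ e
  ... | true = refl
  ... | false = refl
  shuffle false false false d e f = refl

distinctᵇ-∷ʳ : ∀ xs y → distinctᵇ (xs ++ y ∷ []) ≡ not (elemᵇ y xs) ∧ distinctᵇ xs
distinctᵇ-∷ʳ xs y
  rewrite distinctᵇ-middle xs y [] | Boolₚ.∨-identityʳ (elemᵇ y xs) | Listₚ.++-identityʳ xs = refl

PreservesOrder : (ℕ → ℕ) → Set
PreservesOrder f = ∀ a b → (f a <ᵇ f b) ≡ (a <ᵇ b)

module _ (f : ℕ → ℕ) (f-ord : PreservesOrder f) where

  ≡ᵇ-preserved : ∀ a b → (f a ≡ᵇ f b) ≡ (a ≡ᵇ b)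
  ≡ᵇ-preserved a b rewrite ≡ᵇ-via-<ᵇ (f a) (f b) | f-ord a b | f-ord b a = sym (≡ᵇ-via-<ᵇ a b)

  elemᵇ-map : ∀ x xs → elemᵇ (f x) (map f xs) ≡ elemᵇ x xs
  elemᵇ-map x [] = refl
  elemᵇ-map x (y ∷ xs) rewrite ≡ᵇ-preserved x y | elemᵇ-map x xs = refl

  distinctᵇ-map : ∀ xs → distinctᵇ (map f xs) ≡ distinctᵇ xs
  distinctᵇ-map [] = refl
  distinctᵇ-map (x ∷ xs) rewrite elemᵇ-map x xs | distinctᵇ-map xs = refl

  ltPattern-map : ∀ w → ltPattern (map f w) ≡ ltPattern w
  ltPattern-map w = rows w
    where
    row : ∀ x ys → map (λ y → f x <ᵇ y) (map f ys) ≡ map (λ y → x <ᵇ y) ys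
    row x [] = refl
    row x (y ∷ ys) rewrite f-ord x y | row x ys = refl
    rows : ∀ xs → map (λ x → map (λ y → x <ᵇ y) (map f w)) (map f xs)
                ≡ map (λ x → map (λ y → x <ᵇ y) w) xs
    rows [] = refl
    rows (x ∷ xs) rewrite row x w | rows xs = refl

  occ-map : ∀ p w → occ p (map f w) ≡ occ p w
  occ-map p [] = refl
  occ-map p (x ∷ xs)
    rewrite Listₚ.take-map {f = f} (length p) (x ∷ xs) | ltPattern-map (take (length p) (x ∷ xs))
          | Listₚ.length-map f (take (length p) (x ∷ xs)) | occ-map p xs = refl

suc-preservesOrder : PreservesOrder suc
suc-preservesOrder a b = refl

-- The increasing bijection ℕ → ℕ ∖ {y}: it undoes the standardisation after deleting y.
skip : ℕ → ℕ → ℕ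
skip y i = if i <ᵇ y then i else suc i

skip-<ᵇ : ∀ y i → (skip y i <ᵇ y) ≡ (i <ᵇ y)
skip-<ᵇ y i with i <ᵇ y in i<ᵇy
... | true = i<ᵇy
... | false = ≥⇒<ᵇ≡false (suc i) y (≤-trans (<ᵇ≡false⇒≥ i y i<ᵇy) (n≤1+n i))

skip->ᵇ : ∀ y i → (y <ᵇ skip y i) ≡ not (i <ᵇ y)
skip->ᵇ y i with i <ᵇ y in i<ᵇy
... | true = ≥⇒<ᵇ≡false y i (<⇒≤ (<ᵇ≡true⇒< i y i<ᵇy))
... | false = <⇒<ᵇ≡true y (suc i) (s≤s (<ᵇ≡false⇒≥ i y i<ᵇy))

skip-preservesOrder : ∀ y → PreservesOrder (skip y)
skip-preservesOrder y a b with a <ᵇ y in a<ᵇy | b <ᵇ y in b<ᵇy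
... | true | true = refl
... | false | false = refl
... | true | false = trans (<⇒<ᵇ≡true a (suc b) (m≤n⇒m≤1+n a<b)) (sym (<⇒<ᵇ≡true a b a<b))
  where a<b = <-≤-trans (<ᵇ≡true⇒< a y a<ᵇy) (<ᵇ≡false⇒≥ b y b<ᵇy)
... | false | true = trans (≥⇒<ᵇ≡false (suc a) b (m≤n⇒m≤1+n b≤a)) (sym (≥⇒<ᵇ≡false a b b≤a))
  where b≤a = ≤-trans (<⇒≤ (<ᵇ≡true⇒< b y b<ᵇy)) (<ᵇ≡false⇒≥ a y a<ᵇy)

skip-suc : ∀ y i → skip (suc y) (suc i) ≡ suc (skip y i)
skip-suc y i with i <ᵇ y
... | true = refl
... | false = refl

elemᵇ-skip : ∀ y xs → elemᵇ y (map (skip y) xs) ≡ false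
elemᵇ-skip y [] = refl
elemᵇ-skip y (i ∷ xs)
  rewrite elemᵇ-skip y xs | ≡ᵇ-via-<ᵇ y (skip y i) | skip->ᵇ y i | skip-<ᵇ y i with i <ᵇ y
... | true = refl
... | false = refl

skip-onto : ∀ i k p → i ≤ k → p < suc k → p ≢ i → ∃[ q ] (q < k × skip i q ≡ p)
skip-onto i k p i≤k p<k+1 p≢i with <-cmp p i
... | tri< p<i _ _ = p , <-≤-trans p<i i≤k , cong (λ b → if b then p else suc p) (<⇒<ᵇ≡true p i p<i)
... | tri≈ _ p≡i _ = ⊥-elim (p≢i p≡i)
skip-onto i k (suc q) i≤k (s≤s q<k) p≢i | tri> _ _ (s≤s i≤q) =
  q , q<k , cong (λ b → if b then q else suc q) (≥⇒<ᵇ≡false q i i≤q)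

-- Undoes the standardisation after deleting the values 0 and suc i.
raise : ℕ → Word → Word
raise i xs = map suc (map (skip i) xs)

upTo-suc : ∀ n → upTo (suc n) ≡ 0 ∷ map suc (upTo n)
upTo-suc n = cong (0 ∷_) (sym (Listₚ.map-upTo suc n))

remove-0-upTo : ∀ n → remove 0 (upTo (suc n)) ≡ map suc (upTo n)
remove-0-upTo n = trans (cong (remove 0) (upTo-suc n)) (remove-0-map-suc (upTo n))
  where
  remove-0-map-suc : ∀ xs → remove 0 (map suc xs) ≡ map suc xs
  remove-0-map-suc [] = refl
  remove-0-map-suc (x ∷ xs) = cong (suc x ∷_) (remove-0-map-suc xs)

remove-suc-map-suc : ∀ y xs → remove (suc y) (map suc xs) ≡ map suc (remove y xs)
remove-suc-map-suc y [] = refl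
remove-suc-map-suc y (x ∷ xs) with y ≡ᵇ x
... | true = remove-suc-map-suc y xs
... | false = cong (suc x ∷_) (remove-suc-map-suc y xs)

remove-upTo : ∀ n y → y ≤ n → remove y (upTo (suc n)) ≡ map (skip y) (upTo n)
remove-upTo n zero _ = remove-0-upTo n
remove-upTo (suc n) (suc y) (s≤s y≤n) = begin
  remove (suc y) (upTo (suc (suc n)))
    ≡⟨ cong (remove (suc y)) (upTo-suc (suc n)) ⟩
  0 ∷ remove (suc y) (map suc (upTo (suc n)))
    ≡⟨ cong (0 ∷_) (trans (remove-suc-map-suc y (upTo (suc n))) (cong (map suc) (remove-upTo n y y≤n))) ⟩
  0 ∷ map suc (map (skip y) (upTo n))
    ≡⟨ cong (0 ∷_) (trans (sym (Listₚ.map-∘ (upTo n)))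
                   (trans (Listₚ.map-cong (λ i → sym (skip-suc y i)) (upTo n)) (Listₚ.map-∘ (upTo n)))) ⟩
  0 ∷ map (skip (suc y)) (map suc (upTo n))
    ≡⟨ cong (map (skip (suc y))) (upTo-suc n) ⟨
  map (skip (suc y)) (upTo (suc n)) ∎
  where open ≡-Reasoning

∑-wordsOver-remove-0-suc : ∀ k i j (f : Word → ℕ) → i ≤ k →
  ∑[ w ∈ wordsOver (upTo (suc (suc k))) j ] (if elemᵇ 0 w then 0 else (if elemᵇ (suc i) w then 0 else f w))
  ≡ ∑[ w ∈ wordsOver (upTo k) j ] f (raise i w)
∑-wordsOver-remove-0-suc k i j f i≤k = begin
  ∑[ w ∈ wordsOver (upTo (suc (suc k))) j ] (if elemᵇ 0 w then 0 else (if elemᵇ (suc i) w then 0 else f w))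
    ≡⟨ ∑-wordsOver-remove 0 (upTo (suc (suc k))) j _ ⟩
  ∑[ w ∈ wordsOver (remove 0 (upTo (suc (suc k)))) j ] (if elemᵇ (suc i) w then 0 else f w)
    ≡⟨ cong (λ as → ∑[ w ∈ wordsOver as j ] (if elemᵇ (suc i) w then 0 else f w)) (remove-0-upTo (suc k)) ⟩
  ∑[ w ∈ wordsOver (map suc (upTo (suc k))) j ] (if elemᵇ (suc i) w then 0 else f w)
    ≡⟨ ∑-wordsOver-remove (suc i) (map suc (upTo (suc k))) j f ⟩
  ∑ (wordsOver (remove (suc i) (map suc (upTo (suc k)))) j) f
    ≡⟨ cong (λ as → ∑ (wordsOver as j) f) remaining ⟩
  ∑ (wordsOver (map suc (map (skip i) (upTo k))) j) f
    ≡⟨ ∑-wordsOver-map suc (map (skip i) (upTo k)) j f ⟩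
  ∑[ w ∈ wordsOver (map (skip i) (upTo k)) j ] f (map suc w)
    ≡⟨ ∑-wordsOver-map (skip i) (upTo k) j _ ⟩
  ∑[ w ∈ wordsOver (upTo k) j ] f (raise i w) ∎
  where
  open ≡-Reasoning
  remaining : remove (suc i) (map suc (upTo (suc k))) ≡ map suc (map (skip i) (upTo k))
  remaining = trans (remove-suc-map-suc i (upTo (suc k))) (cong (map suc) (remove-upTo k i i≤k))

ind : Bool → ℕ
ind b = if b then 1 else 0

ind-false : ∀ {b} → b ≡ false → ind b ≡ 0
ind-false refl = refl

occursᵇ : Word → Word → Bool
occursᵇ p w = orderIso p (take (length p) w) ∧ (length p ≡ᵇ length (take (length p) w))

occursᵇ-short : ∀ p w → length w < length p → occursᵇ p w ≡ false
occursᵇ-short p w |w|<|p| rewrite Listₚ.take-all (length p) w (<⇒≤ |w|<|p|)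
  with length p ≡ᵇ length w in |p|≡ᵇ|w|
... | true = ⊥-elim (<⇒≢ |w|<|p| (sym (≡ᵇ⇒≡ (length p) (length w) (subst T (sym |p|≡ᵇ|w|) _))))
... | false = Boolₚ.∧-zeroʳ _

-- The length condition is decided by computation, so callers on explicit short lists omit it.
occ-short : ∀ p w → {T (length w <ᵇ length p)} → occ p w ≡ 0
occ-short p [] = refl
occ-short p (x ∷ xs) {|w|<ᵇ|p|} = cong₂ _+_
  (ind-false (occursᵇ-short p (x ∷ xs) |w|<|p|))
  (occ-short p xs {Equivalence.from Boolₚ.T-≡ (<⇒<ᵇ≡true _ _ (<-trans (n<1+n _) |w|<|p|))})
  where |w|<|p| = <ᵇ⇒< (length (x ∷ xs)) (length p) |w|<ᵇ|p|

module TrailingZero₃ (x y z : ℕ)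
  (no-end : ∀ a b → occursᵇ (x ∷ y ∷ z ∷ []) (a ∷ b ∷ 0 ∷ []) ≡ false)
  (no-middle : ∀ b v → occursᵇ (x ∷ y ∷ z ∷ []) (b ∷ 0 ∷ v ∷ []) ≡ false) where

  private
    p : Word
    p = x ∷ y ∷ z ∷ []

  occ-∷ʳ-0 : ∀ xs → occ p (xs ++ 0 ∷ []) ≡ occ p xs
  occ-∷ʳ-0 [] = occ-short p (0 ∷ [])
  occ-∷ʳ-0 (a ∷ []) = trans (occ-short p (a ∷ 0 ∷ [])) (sym (occ-short p (a ∷ [])))
  occ-∷ʳ-0 (a ∷ b ∷ []) =
    trans (cong₂ _+_ (ind-false (no-end a b)) (occ-short p (b ∷ 0 ∷ []))) (sym (occ-short p (a ∷ b ∷ [])))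
  occ-∷ʳ-0 (a ∷ b ∷ c ∷ xs) = cong (ind (occursᵇ p (a ∷ b ∷ c ∷ [])) +_) (occ-∷ʳ-0 (b ∷ c ∷ xs))

  occ-++-0∷v : ∀ xs v → occ p (xs ++ 0 ∷ v ∷ []) ≡ occ p xs
  occ-++-0∷v [] v = occ-short p (0 ∷ v ∷ [])
  occ-++-0∷v (a ∷ []) v =
    trans (cong₂ _+_ (ind-false (no-middle a v)) (occ-short p (0 ∷ v ∷ []))) (sym (occ-short p (a ∷ [])))
  occ-++-0∷v (a ∷ b ∷ []) v =
    trans (cong₂ _+_ (ind-false (no-end a b)) (cong₂ _+_ (ind-false (no-middle b v)) (occ-short p (0 ∷ v ∷ []))))
          (sym (occ-short p (a ∷ b ∷ [])))
  occ-++-0∷v (a ∷ b ∷ c ∷ xs) v =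
    cong (ind (occursᵇ p (a ∷ b ∷ c ∷ [])) +_) (occ-++-0∷v (b ∷ c ∷ xs) v)

p123-no-end : ∀ a b → occursᵇ p123 (a ∷ b ∷ 0 ∷ []) ≡ false
p123-no-end a b rewrite <ᵇ-irrefl a with a <ᵇ b
... | true = refl
... | false = refl

p123-no-middle : ∀ b v → occursᵇ p123 (b ∷ 0 ∷ v ∷ []) ≡ false
p123-no-middle b v rewrite <ᵇ-irrefl b = refl

p132-no-end : ∀ a b → occursᵇ p132 (a ∷ b ∷ 0 ∷ []) ≡ false
p132-no-end a b rewrite <ᵇ-irrefl a with a <ᵇ b
... | true = refl
... | false = refl

p132-no-middle : ∀ b v → occursᵇ p132 (b ∷ 0 ∷ v ∷ []) ≡ false
p132-no-middle b v rewrite <ᵇ-irrefl b = refl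

module TrailingZero-123 = TrailingZero₃ 0 1 2 p123-no-end p123-no-middle
module TrailingZero-132 = TrailingZero₃ 0 2 1 p132-no-end p132-no-middle

onLastTwo : (ℕ → ℕ → Bool) → Word → Bool
onLastTwo P (b ∷ c ∷ []) = P b c
onLastTwo P (a ∷ b ∷ c ∷ xs) = onLastTwo P (b ∷ c ∷ xs)
onLastTwo P _ = false

onLastTwo-++-∷-∷ : ∀ P xs b c → onLastTwo P (xs ++ b ∷ c ∷ []) ≡ P b c
onLastTwo-++-∷-∷ P [] b c = refl
onLastTwo-++-∷-∷ P (a ∷ []) b c = refl
onLastTwo-++-∷-∷ P (a ∷ a′ ∷ []) b c = refl
onLastTwo-++-∷-∷ P (a ∷ a′ ∷ a″ ∷ xs) b c = onLastTwo-++-∷-∷ P (a′ ∷ a″ ∷ xs) b c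

onLastTwo-∷ʳ : ∀ P xs c → (∀ b → P b c ≡ false) → onLastTwo P (xs ++ c ∷ []) ≡ false
onLastTwo-∷ʳ P [] c P≡false = refl
onLastTwo-∷ʳ P (b ∷ []) c P≡false = P≡false b
onLastTwo-∷ʳ P (a ∷ b ∷ []) c P≡false = P≡false b
onLastTwo-∷ʳ P (a ∷ b ∷ b′ ∷ xs) c P≡false = onLastTwo-∷ʳ P (b ∷ b′ ∷ xs) c P≡false

onLastTwo-map : ∀ P (f : ℕ → ℕ) xs → onLastTwo P (map f xs) ≡ onLastTwo (λ b c → P (f b) (f c)) xs
onLastTwo-map P f [] = refl
onLastTwo-map P f (b ∷ []) = refl
onLastTwo-map P f (b ∷ c ∷ []) = refl
onLastTwo-map P f (a ∷ b ∷ c ∷ xs) = onLastTwo-map P f (b ∷ c ∷ xs)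

onLastTwo-cong : ∀ {P Q} xs → (∀ b c → P b c ≡ Q b c) → onLastTwo P xs ≡ onLastTwo Q xs
onLastTwo-cong [] P≗Q = refl
onLastTwo-cong (b ∷ []) P≗Q = refl
onLastTwo-cong (b ∷ c ∷ []) P≗Q = P≗Q b c
onLastTwo-cong (a ∷ b ∷ c ∷ xs) P≗Q = onLastTwo-cong (b ∷ c ∷ xs) P≗Q

completes2314 : ℕ → Word → Bool
completes2314 v = onLastTwo (λ b c → occursᵇ p2314 (b ∷ c ∷ 0 ∷ v ∷ []))

p2314-no-end : ∀ a b c → occursᵇ p2314 (a ∷ b ∷ c ∷ 0 ∷ []) ≡ false
p2314-no-end a b c rewrite <ᵇ-irrefl a with a <ᵇ b | a <ᵇ c
... | true | true = refl
... | true | false = refl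
... | false | _ = refl

occ-2314-∷ʳ-0 : ∀ xs → occ p2314 (xs ++ 0 ∷ []) ≡ occ p2314 xs
occ-2314-∷ʳ-0 [] = occ-short p2314 (0 ∷ [])
occ-2314-∷ʳ-0 (a ∷ []) = trans (occ-short p2314 (a ∷ 0 ∷ [])) (sym (occ-short p2314 (a ∷ [])))
occ-2314-∷ʳ-0 (a ∷ b ∷ []) = trans (occ-short p2314 (a ∷ b ∷ 0 ∷ [])) (sym (occ-short p2314 (a ∷ b ∷ [])))
occ-2314-∷ʳ-0 (a ∷ b ∷ c ∷ []) =
  trans (cong₂ _+_ (ind-false (p2314-no-end a b c)) (occ-short p2314 (b ∷ c ∷ 0 ∷ [])))
        (sym (occ-short p2314 (a ∷ b ∷ c ∷ [])))
occ-2314-∷ʳ-0 (a ∷ b ∷ c ∷ d ∷ xs) =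
  cong (ind (occursᵇ p2314 (a ∷ b ∷ c ∷ d ∷ [])) +_) (occ-2314-∷ʳ-0 (b ∷ c ∷ d ∷ xs))

occ-2314-++-0∷v : ∀ xs v → occ p2314 (xs ++ 0 ∷ v ∷ []) ≡ occ p2314 xs + ind (completes2314 v xs)
occ-2314-++-0∷v [] v = occ-short p2314 (0 ∷ v ∷ [])
occ-2314-++-0∷v (c ∷ []) v =
  trans (occ-short p2314 (c ∷ 0 ∷ v ∷ [])) (sym (cong (_+ 0) (occ-short p2314 (c ∷ []))))
occ-2314-++-0∷v (b ∷ c ∷ []) v = begin
  ind (occursᵇ p2314 (b ∷ c ∷ 0 ∷ v ∷ [])) + occ p2314 (c ∷ 0 ∷ v ∷ [])
    ≡⟨ cong (ind (occursᵇ p2314 (b ∷ c ∷ 0 ∷ v ∷ [])) +_) (occ-short p2314 (c ∷ 0 ∷ v ∷ [])) ⟩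
  ind (occursᵇ p2314 (b ∷ c ∷ 0 ∷ v ∷ [])) + 0
    ≡⟨ +-comm _ 0 ⟩
  0 + ind (completes2314 v (b ∷ c ∷ []))
    ≡⟨ cong (_+ ind (completes2314 v (b ∷ c ∷ []))) (occ-short p2314 (b ∷ c ∷ [])) ⟨
  occ p2314 (b ∷ c ∷ []) + ind (completes2314 v (b ∷ c ∷ [])) ∎
  where open ≡-Reasoning
occ-2314-++-0∷v (a ∷ b ∷ c ∷ []) v =
  trans (cong₂ _+_ (ind-false (p2314-no-end a b c)) (occ-2314-++-0∷v (b ∷ c ∷ []) v))
        (cong (_+ ind (completes2314 v (b ∷ c ∷ [])))
              (trans (occ-short p2314 (b ∷ c ∷ [])) (sym (occ-short p2314 (a ∷ b ∷ c ∷ [])))))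
occ-2314-++-0∷v (a ∷ b ∷ c ∷ d ∷ xs) v =
  trans (cong (ind (occursᵇ p2314 (a ∷ b ∷ c ∷ d ∷ [])) +_) (occ-2314-++-0∷v (b ∷ c ∷ d ∷ xs) v))
        (sym (+-assoc (ind (occursᵇ p2314 (a ∷ b ∷ c ∷ d ∷ []))) _ _))

occursᵇ-2314-0 : ∀ b c y → occursᵇ p2314 (suc b ∷ suc c ∷ 0 ∷ suc y ∷ []) ≡ (b <ᵇ c) ∧ (c <ᵇ y)
occursᵇ-2314-0 b c y rewrite <ᵇ-irrefl b | <ᵇ-irrefl c | <ᵇ-irrefl y
  with b <ᵇ c in b<ᵇc | c <ᵇ y in c<ᵇy
... | false | _ = refl
... | true | false rewrite <ᵇ-asym b c b<ᵇc = cong (_∧ true) (Boolₚ.∧-zeroʳ _)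
... | true | true rewrite <ᵇ-asym b c b<ᵇc | <ᵇ-asym c y c<ᵇy | <ᵇ-trans b c y b<ᵇc c<ᵇy
                        | <ᵇ-asym b y (<ᵇ-trans b c y b<ᵇc c<ᵇy) = refl

-- The position of the minimum in Av(123, 132)

avoidsᵇ : Word → Bool
avoidsᵇ w = not (containsᵇ p123 w ∨ containsᵇ p132 w)

onAv : (Word → ℕ) → Word → ℕ
onAv g w = if distinctᵇ w then (if avoidsᵇ w then g w else 0) else 0

onAv-cong : ∀ {g h : Word → ℕ} → (∀ w → g w ≡ h w) → ∀ w → onAv g w ≡ onAv h w
onAv-cong g≗h w with distinctᵇ w | avoidsᵇ w
... | true | true = g≗h w
... | true | false = refl
... | false | _ = refl

onAv-+ : ∀ g h w → onAv (λ w → g w + h w) w ≡ onAv g w + onAv h w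
onAv-+ g h w with distinctᵇ w | avoidsᵇ w
... | true | true = refl
... | true | false = refl
... | false | _ = refl

onAv-* : ∀ c w → onAv (λ _ → c) w ≡ c * onAv (λ _ → 1) w
onAv-* c w with distinctᵇ w | avoidsᵇ w
... | true | true = sym (*-identityʳ c)
... | true | false = sym (*-zeroʳ c)
... | false | _ = sym (*-zeroʳ c)

∑-onAv : ∀ {B : Set} (bs : List B) (h : B → Word → ℕ) w →
         ∑[ b ∈ bs ] onAv (h b) w ≡ onAv (λ w → ∑[ b ∈ bs ] h b w) w
∑-onAv bs h w with distinctᵇ w | avoidsᵇ w
... | true | true = refl
... | true | false = ∑-zero bs
... | false | _ = ∑-zero bs

containsᵇ-∷ : ∀ p x w → containsᵇ p w ≡ true → containsᵇ p (x ∷ w) ≡ true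
containsᵇ-∷ p x w p⊑w with occ p w
... | suc n rewrite +-suc (ind (occursᵇ p (x ∷ w))) n = refl

avoidsᵇ-∷ : ∀ x w → avoidsᵇ w ≡ false → avoidsᵇ (x ∷ w) ≡ false
avoidsᵇ-∷ x w w≮ with containsᵇ p123 w in 123⊑w | containsᵇ p132 w in 132⊑w
... | true | _ rewrite containsᵇ-∷ p123 x w 123⊑w = refl
... | false | true rewrite containsᵇ-∷ p132 x w 132⊑w = cong not (Boolₚ.∨-zeroʳ _)
... | false | false with () ← w≮

avoidsᵇ-0∷∷ : ∀ a b r → distinctᵇ (0 ∷ a ∷ b ∷ r) ≡ true → avoidsᵇ (0 ∷ a ∷ b ∷ r) ≡ false
avoidsᵇ-0∷∷ zero b r ()
avoidsᵇ-0∷∷ (suc a) zero r ()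
avoidsᵇ-0∷∷ (suc a) (suc b) r distinct with <-cmp a b
... | tri< a<b _ _
  rewrite <ᵇ-irrefl a | <ᵇ-irrefl b | <⇒<ᵇ≡true a b a<b | <ᵇ-asym a b (<⇒<ᵇ≡true a b a<b) = refl
... | tri> _ _ b<a
  rewrite <ᵇ-irrefl a | <ᵇ-irrefl b | <⇒<ᵇ≡true b a b<a | <ᵇ-asym b a (<⇒<ᵇ≡true b a b<a) =
  cong not (Boolₚ.∨-zeroʳ _)
... | tri≈ _ refl _ rewrite ≡ᵇ-refl a with () ← trans (sym (Boolₚ.∧-zeroʳ _)) distinct

avoidsᵇ-0∈ : ∀ ρ u v → elemᵇ 0 ρ ≡ true → distinctᵇ (ρ ++ u ∷ v ∷ []) ≡ true →
             avoidsᵇ (ρ ++ u ∷ v ∷ []) ≡ false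
avoidsᵇ-0∈ (zero ∷ []) u v _ distinct = avoidsᵇ-0∷∷ u v [] distinct
avoidsᵇ-0∈ (zero ∷ c ∷ []) u v _ distinct = avoidsᵇ-0∷∷ c u (v ∷ []) distinct
avoidsᵇ-0∈ (zero ∷ c ∷ d ∷ ρ) u v _ distinct = avoidsᵇ-0∷∷ c d (ρ ++ u ∷ v ∷ []) distinct
avoidsᵇ-0∈ (suc x ∷ ρ) u v 0∈ρ distinct =
  avoidsᵇ-∷ (suc x) (ρ ++ u ∷ v ∷ []) (avoidsᵇ-0∈ ρ u v 0∈ρ (Boolₚ.∧-conicalʳ _ _ distinct))

onAv-0∈ : ∀ g ρ u v → elemᵇ 0 ρ ≡ true → onAv g (ρ ++ u ∷ v ∷ []) ≡ 0
onAv-0∈ g ρ u v 0∈ρ with distinctᵇ (ρ ++ u ∷ v ∷ []) in distinct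
... | false = refl
... | true rewrite avoidsᵇ-0∈ ρ u v 0∈ρ distinct = refl

onAv-∷ʳ-0 : ∀ g τ → onAv g (τ ++ 0 ∷ []) ≡ (if elemᵇ 0 τ then 0 else onAv g (τ ++ 0 ∷ []))
onAv-∷ʳ-0 g τ rewrite distinctᵇ-∷ʳ τ 0 with elemᵇ 0 τ
... | true = refl
... | false = refl

onAv-++-0∷suc : ∀ g ρ y → onAv g (ρ ++ 0 ∷ suc y ∷ []) ≡
  (if elemᵇ 0 ρ then 0 else (if elemᵇ (suc y) ρ then 0 else onAv g (ρ ++ 0 ∷ suc y ∷ [])))
onAv-++-0∷suc g ρ y rewrite distinctᵇ-middle ρ 0 (suc y ∷ []) | distinctᵇ-∷ʳ ρ (suc y)
  with elemᵇ 0 ρ | elemᵇ (suc y) ρ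
... | true | _ = refl
... | false | true = refl
... | false | false = refl

-- The two ways of building a permutation of size k + 2 avoiding 123 and 132 by
-- placing its minimum: last (from one of size k + 1), or second to last, followed
-- by suc y (from one of size k).
extend₁ : Word → Word
extend₁ τ = map suc τ ++ 0 ∷ []

extend₂ : ℕ → Word → Word
extend₂ y σ = raise y σ ++ 0 ∷ suc y ∷ []

onAv-extend₁ : ∀ g τ → onAv g (extend₁ τ) ≡ onAv (λ τ → g (extend₁ τ)) τ
onAv-extend₁ g τ
  rewrite distinctᵇ-∷ʳ (map suc τ) 0 | elemᵇ-0-map-suc τ | distinctᵇ-map suc suc-preservesOrder τ
        | TrailingZero-123.occ-∷ʳ-0 (map suc τ) | TrailingZero-132.occ-∷ʳ-0 (map suc τ)
        | occ-map suc suc-preservesOrder p123 τ | occ-map suc suc-preservesOrder p132 τ = refl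

onAv-extend₂ : ∀ g y σ → onAv g (extend₂ y σ) ≡ onAv (λ σ → g (extend₂ y σ)) σ
onAv-extend₂ g y σ
  rewrite distinctᵇ-middle (raise y σ) 0 (suc y ∷ [])
        | distinctᵇ-∷ʳ (raise y σ) (suc y)
        | elemᵇ-map suc suc-preservesOrder y (map (skip y) σ) | elemᵇ-skip y σ | elemᵇ-0-map-suc (map (skip y) σ)
        | distinctᵇ-map suc suc-preservesOrder (map (skip y) σ) | distinctᵇ-map (skip y) (skip-preservesOrder y) σ
        | TrailingZero-123.occ-++-0∷v (raise y σ) (suc y)
        | TrailingZero-132.occ-++-0∷v (raise y σ) (suc y)
        | occ-map suc suc-preservesOrder p123 (map (skip y) σ) | occ-map suc suc-preservesOrder p132 (map (skip y) σ)
        | occ-map (skip y) (skip-preservesOrder y) p123 σ | occ-map (skip y) (skip-preservesOrder y) p132 σ = refl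

-- On distinct words, ∑Words n ranges over S_n in one-line notation.
∑Words : ℕ → (Word → ℕ) → ℕ
∑Words n f = ∑ (wordsOver (upTo n) n) f

module Decomposition (g : Word → ℕ) (k : ℕ) where
  open ≡-Reasoning

  private
    [k+2] [k+1] [k] : List ℕ
    [k+2] = upTo (suc (suc k))
    [k+1] = upTo (suc k)
    [k] = upTo k

  onAv∋0 : Word → ℕ
  onAv∋0 w = if elemᵇ 0 w then onAv g w else 0

  -- Pigeonhole: a word of length k + 2 over {1, …, k + 1} repeats a letter.
  ∑-onAv≡∑-onAv∋0 :
    ∑ (wordsOver [k+2] (suc (suc k))) (onAv g) ≡ ∑ (wordsOver [k+2] (suc (suc k))) onAv∋0
  ∑-onAv≡∑-onAv∋0 = begin
    ∑ (wordsOver [k+2] (suc (suc k))) (onAv g)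
      ≡⟨ ∑-cong (wordsOver [k+2] (suc (suc k))) split ⟩
    ∑[ w ∈ wordsOver [k+2] (suc (suc k)) ] (onAv∋0 w + (if elemᵇ 0 w then 0 else onAv g w))
      ≡⟨ ∑-+ (wordsOver [k+2] (suc (suc k))) onAv∋0 _ ⟩
    ∑ (wordsOver [k+2] (suc (suc k))) onAv∋0
      + ∑[ w ∈ wordsOver [k+2] (suc (suc k)) ] (if elemᵇ 0 w then 0 else onAv g w)
      ≡⟨ cong (∑ (wordsOver [k+2] (suc (suc k))) onAv∋0 +_)
              (trans (∑-wordsOver-remove 0 [k+2] (suc (suc k)) (onAv g)) noZero) ⟩
    ∑ (wordsOver [k+2] (suc (suc k))) onAv∋0 + 0
      ≡⟨ +-identityʳ _ ⟩
    ∑ (wordsOver [k+2] (suc (suc k))) onAv∋0 ∎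
    where
    split : ∀ w → onAv g w ≡ onAv∋0 w + (if elemᵇ 0 w then 0 else onAv g w)
    split w with elemᵇ 0 w
    ... | true = sym (+-identityʳ _)
    ... | false = refl
    |remove0|<k+2 : length (remove 0 [k+2]) < suc (suc k)
    |remove0|<k+2 = ≤-reflexive (cong suc
      (trans (cong length (remove-0-upTo (suc k))) (trans (Listₚ.length-map suc [k+1]) (Listₚ.length-upTo (suc k)))))
    noZero : ∑ (wordsOver (remove 0 [k+2]) (suc (suc k))) (onAv g) ≡ 0
    noZero = ∑-wordsOver-pigeonhole (suc (suc k)) (remove 0 [k+2]) _ |remove0|<k+2

  ∑-min-last :
    ∑[ τ ∈ wordsOver [k+2] (suc k) ] onAv∋0 (τ ++ 0 ∷ []) ≡ ∑ (wordsOver [k+1] (suc k)) (onAv (g ∘ extend₁))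
  ∑-min-last = begin
    ∑[ τ ∈ wordsOver [k+2] (suc k) ] onAv∋0 (τ ++ 0 ∷ [])
      ≡⟨ ∑-cong (wordsOver [k+2] (suc k)) (λ τ → trans (0∈τ++0 τ) (onAv-∷ʳ-0 g τ)) ⟩
    ∑[ τ ∈ wordsOver [k+2] (suc k) ] (if elemᵇ 0 τ then 0 else onAv g (τ ++ 0 ∷ []))
      ≡⟨ ∑-wordsOver-remove 0 [k+2] (suc k) _ ⟩
    ∑[ τ ∈ wordsOver (remove 0 [k+2]) (suc k) ] onAv g (τ ++ 0 ∷ [])
      ≡⟨ cong (λ as → ∑[ τ ∈ wordsOver as (suc k) ] onAv g (τ ++ 0 ∷ [])) (remove-0-upTo (suc k)) ⟩
    ∑[ τ ∈ wordsOver (map suc [k+1]) (suc k) ] onAv g (τ ++ 0 ∷ [])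
      ≡⟨ ∑-wordsOver-map suc [k+1] (suc k) _ ⟩
    ∑[ τ ∈ wordsOver [k+1] (suc k) ] onAv g (extend₁ τ)
      ≡⟨ ∑-cong (wordsOver [k+1] (suc k)) (onAv-extend₁ g) ⟩
    ∑ (wordsOver [k+1] (suc k)) (onAv (g ∘ extend₁)) ∎
    where
    0∈τ++0 : ∀ τ → onAv∋0 (τ ++ 0 ∷ []) ≡ onAv g (τ ++ 0 ∷ [])
    0∈τ++0 τ rewrite elemᵇ-++ 0 τ (0 ∷ []) | Boolₚ.∨-zeroʳ (elemᵇ 0 τ) = refl

  ∑-min-second-to-last : ∀ y → y ≤ k →
    ∑[ τ ∈ wordsOver [k+2] (suc k) ] onAv∋0 (τ ++ suc y ∷ []) ≡ ∑ (wordsOver [k] k) (onAv (g ∘ extend₂ y))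
  ∑-min-second-to-last y y≤k = begin
    ∑[ τ ∈ wordsOver [k+2] (suc k) ] onAv∋0 (τ ++ suc y ∷ [])
      ≡⟨ ∑-wordsOver-∷ʳ [k+2] k _ ⟩
    ∑[ ρ ∈ wordsOver [k+2] k ] ∑[ u ∈ [k+2] ] onAv∋0 ((ρ ++ u ∷ []) ++ suc y ∷ [])
      ≡⟨ ∑-cong (wordsOver [k+2] k) onlyZero ⟩
    ∑[ ρ ∈ wordsOver [k+2] k ]
      (if elemᵇ 0 ρ then 0 else (if elemᵇ (suc y) ρ then 0 else onAv g (ρ ++ 0 ∷ suc y ∷ [])))
      ≡⟨ ∑-wordsOver-remove-0-suc k y k _ y≤k ⟩
    ∑[ σ ∈ wordsOver [k] k ] onAv g (extend₂ y σ)
      ≡⟨ ∑-cong (wordsOver [k] k) (onAv-extend₂ g y) ⟩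
    ∑ (wordsOver [k] k) (onAv (g ∘ extend₂ y)) ∎
    where
    onlyZero : ∀ ρ → ∑[ u ∈ [k+2] ] onAv∋0 ((ρ ++ u ∷ []) ++ suc y ∷ [])
                   ≡ (if elemᵇ 0 ρ then 0 else (if elemᵇ (suc y) ρ then 0 else onAv g (ρ ++ 0 ∷ suc y ∷ [])))
    onlyZero ρ = begin
      ∑[ u ∈ [k+2] ] onAv∋0 ((ρ ++ u ∷ []) ++ suc y ∷ [])
        ≡⟨ ∑-upTo-suc (suc k) (λ u → onAv∋0 ((ρ ++ u ∷ []) ++ suc y ∷ [])) ⟩
      onAv∋0 ((ρ ++ 0 ∷ []) ++ suc y ∷ []) + ∑[ z ∈ [k+1] ] onAv∋0 ((ρ ++ suc z ∷ []) ++ suc y ∷ [])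
        ≡⟨ cong₂ _+_ zero-second-to-last (trans (∑-cong [k+1] positive-second-to-last) (∑-zero [k+1])) ⟩
      onAv g (ρ ++ 0 ∷ suc y ∷ []) + 0
        ≡⟨ +-identityʳ _ ⟩
      onAv g (ρ ++ 0 ∷ suc y ∷ [])
        ≡⟨ onAv-++-0∷suc g ρ y ⟩
      (if elemᵇ 0 ρ then 0 else (if elemᵇ (suc y) ρ then 0 else onAv g (ρ ++ 0 ∷ suc y ∷ []))) ∎
      where
      zero-second-to-last : onAv∋0 ((ρ ++ 0 ∷ []) ++ suc y ∷ []) ≡ onAv g (ρ ++ 0 ∷ suc y ∷ [])
      zero-second-to-last
        rewrite Listₚ.++-assoc ρ (0 ∷ []) (suc y ∷ [])
              | elemᵇ-++ 0 ρ (0 ∷ suc y ∷ []) | Boolₚ.∨-zeroʳ (elemᵇ 0 ρ) = refl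
      positive-second-to-last : ∀ z → onAv∋0 ((ρ ++ suc z ∷ []) ++ suc y ∷ []) ≡ 0
      positive-second-to-last z
        rewrite Listₚ.++-assoc ρ (suc z ∷ []) (suc y ∷ [])
              | elemᵇ-++ 0 ρ (suc z ∷ suc y ∷ []) | Boolₚ.∨-identityʳ (elemᵇ 0 ρ)
        with elemᵇ 0 ρ in 0∈ρ
      ... | true = onAv-0∈ g ρ (suc z) (suc y) 0∈ρ
      ... | false = refl

  ∑-onAv-decompose :
    ∑Words (suc (suc k)) (onAv g)
    ≡ ∑Words (suc k) (onAv (g ∘ extend₁)) + ∑[ y ∈ [k+1] ] ∑Words k (onAv (g ∘ extend₂ y))
  ∑-onAv-decompose = begin
    ∑ (wordsOver [k+2] (suc (suc k))) (onAv g)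
      ≡⟨ ∑-onAv≡∑-onAv∋0 ⟩
    ∑ (wordsOver [k+2] (suc (suc k))) onAv∋0
      ≡⟨ ∑-wordsOver-∷ʳ [k+2] (suc k) onAv∋0 ⟩
    ∑[ τ ∈ wordsOver [k+2] (suc k) ] ∑[ v ∈ [k+2] ] onAv∋0 (τ ++ v ∷ [])
      ≡⟨ ∑-cong (wordsOver [k+2] (suc k)) (λ τ → ∑-upTo-suc (suc k) (λ v → onAv∋0 (τ ++ v ∷ []))) ⟩
    ∑[ τ ∈ wordsOver [k+2] (suc k) ] (onAv∋0 (τ ++ 0 ∷ []) + ∑[ y ∈ [k+1] ] onAv∋0 (τ ++ suc y ∷ []))
      ≡⟨ ∑-+ (wordsOver [k+2] (suc k)) _ _ ⟩
    ∑[ τ ∈ wordsOver [k+2] (suc k) ] onAv∋0 (τ ++ 0 ∷ [])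
      + ∑[ τ ∈ wordsOver [k+2] (suc k) ] ∑[ y ∈ [k+1] ] onAv∋0 (τ ++ suc y ∷ [])
      ≡⟨ cong₂ _+_ ∑-min-last (∑-swap (wordsOver [k+2] (suc k)) [k+1] _) ⟩
    ∑Words (suc k) (onAv (g ∘ extend₁)) + ∑[ y ∈ [k+1] ] ∑[ τ ∈ wordsOver [k+2] (suc k) ] onAv∋0 (τ ++ suc y ∷ [])
      ≡⟨ cong (∑Words (suc k) (onAv (g ∘ extend₁)) +_)
              (∑-upTo-cong (suc k) λ y y<k+1 → ∑-min-second-to-last y (≤-pred y<k+1)) ⟩
    ∑Words (suc k) (onAv (g ∘ extend₁)) + ∑[ y ∈ [k+1] ] ∑Words k (onAv (g ∘ extend₂ y)) ∎

open Decomposition using (∑-onAv-decompose)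

-- Counting occurrences of 2314

numAv : ℕ → ℕ
numAv n = ∑Words n (onAv (λ _ → 1))

total2314 : ℕ → ℕ
total2314 n = ∑Words n (onAv (occ p2314))

ascentBelow : ℕ → Word → Bool
ascentBelow y = onLastTwo (λ b c → (b <ᵇ c) ∧ (c <ᵇ y))

-- The occurrences of 2314 created by extend₂, ending at its last entry.
newOccurrences : ℕ → ℕ
newOccurrences k = ∑Words k (onAv (λ σ → ∑[ y ∈ upTo (suc k) ] ind (ascentBelow y σ)))

count2314≡total2314 : ∀ n → count2314 n ≡ total2314 n
count2314≡total2314 n =
  trans (sum-map≡∑ (occ p2314) (av123-132 n))
  (trans (∑-filter avoidsᵇ (perms n) (occ p2314))
  (trans (∑-filter distinctᵇ (words n n) (λ w → if avoidsᵇ w then occ p2314 w else 0))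
         (cong (λ ws → ∑ ws (onAv (occ p2314))) (words≡wordsOver n n))))

numAv-rec : ∀ k → numAv (suc (suc k)) ≡ numAv (suc k) + suc k * numAv k
numAv-rec k = trans (∑-onAv-decompose (λ _ → 1) k) (cong (numAv (suc k) +_) (∑-upTo-const (suc k) (numAv k)))

occ-extend₁ : ∀ τ → occ p2314 (extend₁ τ) ≡ occ p2314 τ
occ-extend₁ τ = trans (occ-2314-∷ʳ-0 (map suc τ)) (occ-map suc suc-preservesOrder p2314 τ)

completes2314-raise : ∀ y σ → completes2314 (suc y) (raise y σ) ≡ ascentBelow y σ
completes2314-raise y σ =
  trans (onLastTwo-map _ suc (map (skip y) σ))
  (trans (onLastTwo-map _ (skip y) σ)
         (onLastTwo-cong σ λ b c → trans (occursᵇ-2314-0 (skip y b) (skip y c) y)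
                                         (cong₂ _∧_ (skip-preservesOrder y b c) (skip-<ᵇ y c))))

occ-extend₂ : ∀ y σ → occ p2314 (extend₂ y σ) ≡ occ p2314 σ + ind (ascentBelow y σ)
occ-extend₂ y σ =
  trans (occ-2314-++-0∷v (raise y σ) (suc y)) (cong₂ _+_ occ-raise (cong ind (completes2314-raise y σ)))
  where
  occ-raise : occ p2314 (raise y σ) ≡ occ p2314 σ
  occ-raise =
    trans (occ-map suc suc-preservesOrder p2314 (map (skip y) σ)) (occ-map (skip y) (skip-preservesOrder y) p2314 σ)

total2314-rec : ∀ k → total2314 (suc (suc k)) ≡ total2314 (suc k) + suc k * total2314 k + newOccurrences k
total2314-rec k = begin
  total2314 (suc (suc k))
    ≡⟨ ∑-onAv-decompose (occ p2314) k ⟩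
  ∑Words (suc k) (onAv (occ p2314 ∘ extend₁)) + ∑[ y ∈ [k+1] ] ∑Words k (onAv (occ p2314 ∘ extend₂ y))
    ≡⟨ cong₂ _+_ (∑-cong (wordsOver [k+1] (suc k)) (onAv-cong occ-extend₁))
                 (∑-cong [k+1] λ y → ∑-cong (wordsOver [k] k) (split y)) ⟩
  total2314 (suc k) + ∑[ y ∈ [k+1] ] ∑[ σ ∈ wordsOver [k] k ] (onAv (occ p2314) σ + new y σ)
    ≡⟨ cong (total2314 (suc k) +_) (∑-cong [k+1] λ y → ∑-+ (wordsOver [k] k) _ _) ⟩
  total2314 (suc k) + ∑[ y ∈ [k+1] ] (total2314 k + ∑Words k (new y))
    ≡⟨ cong (total2314 (suc k) +_) (∑-+ [k+1] (λ _ → total2314 k) _) ⟩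
  total2314 (suc k) + (∑[ _ ∈ [k+1] ] total2314 k + ∑[ y ∈ [k+1] ] ∑Words k (new y))
    ≡⟨ +-assoc (total2314 (suc k)) _ _ ⟨
  total2314 (suc k) + ∑[ _ ∈ [k+1] ] total2314 k + ∑[ y ∈ [k+1] ] ∑Words k (new y)
    ≡⟨ cong₂ (λ a b → total2314 (suc k) + a + b) (∑-upTo-const (suc k) (total2314 k))
             (trans (∑-swap [k+1] (wordsOver [k] k) _)
                    (∑-cong (wordsOver [k] k) (∑-onAv [k+1] (λ y → ind ∘ ascentBelow y)))) ⟩
  total2314 (suc k) + suc k * total2314 k + newOccurrences k ∎
  where
  open ≡-Reasoning
  [k+1] [k] : List ℕ
  [k+1] = upTo (suc k)
  [k] = upTo k
  new : ℕ → Word → ℕ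
  new y = onAv (ind ∘ ascentBelow y)
  split : ∀ y σ → onAv (occ p2314 ∘ extend₂ y) σ ≡ onAv (occ p2314) σ + new y σ
  split y σ = trans (onAv-cong (occ-extend₂ y) σ) (onAv-+ (occ p2314) (ind ∘ ascentBelow y) σ)

∑-upTo-ind-<ᵇ : ∀ a n → ∑[ y ∈ upTo n ] ind (a <ᵇ y) ≡ n ∸ suc a
∑-upTo-ind-<ᵇ a zero = refl
∑-upTo-ind-<ᵇ zero (suc n) =
  trans (∑-upTo-suc n (λ y → ind (0 <ᵇ y))) (trans (∑-upTo-const n 1) (*-identityʳ n))
∑-upTo-ind-<ᵇ (suc a) (suc n) = trans (∑-upTo-suc n (λ y → ind (suc a <ᵇ y))) (∑-upTo-ind-<ᵇ a n)

∑-upTo-∸≡C2 : ∀ j → ∑[ y ∈ upTo (suc j) ] (suc j ∸ y) ≡ suc (suc j) C 2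
∑-upTo-∸≡C2 zero = refl
∑-upTo-∸≡C2 (suc j) = begin
  ∑[ y ∈ upTo (suc (suc j)) ] (suc (suc j) ∸ y)
    ≡⟨ ∑-upTo-suc (suc j) (λ y → suc (suc j) ∸ y) ⟩
  suc (suc j) + ∑[ y ∈ upTo (suc j) ] (suc j ∸ y)
    ≡⟨ cong₂ _+_ (sym (nC1≡n (suc (suc j)))) (∑-upTo-∸≡C2 j) ⟩
  suc (suc j) C 1 + suc (suc j) C 2
    ≡⟨ nCk+nC[k+1]≡[n+1]C[k+1] (suc (suc j)) 1 ⟩
  suc (suc (suc j)) C 2 ∎
  where open ≡-Reasoning

-- A new occurrence needs an ascent b c below the last entry y; in a permutation built by
-- extend₂ y′ that ascent is 0 (suc y′), so every y > suc y′ qualifies.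
newOccurrences-rec : ∀ j → newOccurrences (suc (suc j)) ≡ (suc (suc j) C 2) * numAv j
newOccurrences-rec j = begin
  newOccurrences (suc (suc j))
    ≡⟨ ∑-onAv-decompose ascents j ⟩
  ∑Words (suc j) (onAv (ascents ∘ extend₁)) + ∑[ y′ ∈ upTo (suc j) ] ∑Words j (onAv (ascents ∘ extend₂ y′))
    ≡⟨ cong₂ _+_ (trans (∑-cong (wordsOver (upTo (suc j)) (suc j)) (onAv-cong ascents-extend₁))
                        (∑-cong (wordsOver (upTo (suc j)) (suc j)) (onAv-* 0)))
                 (∑-cong (upTo (suc j)) λ y′ → ∑-cong (wordsOver (upTo j) j) λ σ →
                   trans (onAv-cong (ascents-extend₂ y′) σ) (onAv-* (suc j ∸ y′) σ)) ⟩
  ∑Words (suc j) (λ _ → 0)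
    + ∑[ y′ ∈ upTo (suc j) ] ∑[ σ ∈ wordsOver (upTo j) j ] ((suc j ∸ y′) * onAv (λ _ → 1) σ)
    ≡⟨ cong₂ _+_ (∑-zero (wordsOver (upTo (suc j)) (suc j))) (∑-cong (upTo (suc j)) λ y′ →
                 trans (∑-*ˡ (wordsOver (upTo j) j) (suc j ∸ y′) _) (*-comm (suc j ∸ y′) (numAv j))) ⟩
  ∑[ y′ ∈ upTo (suc j) ] (numAv j * (suc j ∸ y′))
    ≡⟨ ∑-*ˡ (upTo (suc j)) (numAv j) (λ y′ → suc j ∸ y′) ⟩
  numAv j * ∑[ y′ ∈ upTo (suc j) ] (suc j ∸ y′)
    ≡⟨ cong (numAv j *_) (∑-upTo-∸≡C2 j) ⟩
  numAv j * (suc (suc j) C 2)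
    ≡⟨ *-comm (numAv j) _ ⟩
  (suc (suc j) C 2) * numAv j ∎
  where
  open ≡-Reasoning
  [j+3] : List ℕ
  [j+3] = upTo (suc (suc (suc j)))
  ascents : Word → ℕ
  ascents σ = ∑[ y ∈ [j+3] ] ind (ascentBelow y σ)
  ascents-extend₁ : ∀ τ → ascents (extend₁ τ) ≡ 0
  ascents-extend₁ τ =
    trans (∑-cong [j+3] λ y → cong ind (onLastTwo-∷ʳ _ (map suc τ) 0 (λ b → refl))) (∑-zero [j+3])
  ascents-extend₂ : ∀ y′ σ → ascents (extend₂ y′ σ) ≡ suc j ∸ y′
  ascents-extend₂ y′ σ = trans (∑-cong [j+3] λ y → cong ind (onLastTwo-++-∷-∷ _ (raise y′ σ) 0 (suc y′)))
                               (∑-upTo-ind-<ᵇ (suc y′) (suc (suc (suc j))))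

-- Involutions

lookupℕ-++ˡ : ∀ xs ys i → i < length xs → lookupℕ (xs ++ ys) i ≡ lookupℕ xs i
lookupℕ-++ˡ (x ∷ xs) ys zero _ = refl
lookupℕ-++ˡ (x ∷ xs) ys (suc i) (s≤s i<|xs|) = lookupℕ-++ˡ xs ys i i<|xs|

lookupℕ-++ʳ : ∀ xs ys i → lookupℕ (xs ++ ys) (length xs + i) ≡ lookupℕ ys i
lookupℕ-++ʳ [] ys i = refl
lookupℕ-++ʳ (x ∷ xs) ys i = lookupℕ-++ʳ xs ys i

lookupℕ-middle : ∀ xs y ys → lookupℕ (xs ++ y ∷ ys) (length xs) ≡ y
lookupℕ-middle xs y ys =
  trans (cong (lookupℕ (xs ++ y ∷ ys)) (sym (+-identityʳ (length xs)))) (lookupℕ-++ʳ xs (y ∷ ys) 0)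

lookupℕ-map : ∀ f xs i → i < length xs → lookupℕ (map f xs) i ≡ f (lookupℕ xs i)
lookupℕ-map f (x ∷ xs) zero _ = refl
lookupℕ-map f (x ∷ xs) (suc i) (s≤s i<|xs|) = lookupℕ-map f xs i i<|xs|

lookupℕ-All : ∀ {P : ℕ → Set} xs i → All P xs → i < length xs → P (lookupℕ xs i)
lookupℕ-All (x ∷ xs) zero (px ∷ _) _ = px
lookupℕ-All (x ∷ xs) (suc i) (_ ∷ pxs) (s≤s i<|xs|) = lookupℕ-All xs i pxs i<|xs|

allᵇ-applyUpTo⁻ : ∀ (f : ℕ → Bool) g n →
                  allᵇ f (applyUpTo g n) ≡ true → ∀ j → j < n → f (g j) ≡ true
allᵇ-applyUpTo⁻ f g (suc n) all-f j j<n with f (g 0) in fg0 | j | j<n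
... | true | zero | _ = fg0
... | true | suc j′ | s≤s j′<n = allᵇ-applyUpTo⁻ f (g ∘ suc) n all-f j′ j′<n

allᵇ-applyUpTo⁺ : ∀ (f : ℕ → Bool) g n →
                  (∀ j → j < n → f (g j) ≡ true) → allᵇ f (applyUpTo g n) ≡ true
allᵇ-applyUpTo⁺ f g zero _ = refl
allᵇ-applyUpTo⁺ f g (suc n) f∘g rewrite f∘g 0 z<s =
  allᵇ-applyUpTo⁺ f (g ∘ suc) n (λ j j<n → f∘g (suc j) (s<s j<n))

fixedByTwiceᵇ : Word → ℕ → Bool
fixedByTwiceᵇ w j = lookupℕ w (lookupℕ w j) ≡ᵇ j

isInvolutionᵇ-transfer : ∀ w v (e : ℕ → ℕ) →
  (∀ q → q < length v → e q < length w × fixedByTwiceᵇ w (e q) ≡ fixedByTwiceᵇ v q) →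
  (∀ p → p < length w → fixedByTwiceᵇ w p ≡ true ⊎ ∃[ q ] (q < length v × e q ≡ p)) →
  isInvolutionᵇ w ≡ isInvolutionᵇ v
isInvolutionᵇ-transfer w v e along-e outside-e = Boolₚ.⇔→≡ {z = true} (mk⇔ to from)
  where
  to : isInvolutionᵇ w ≡ true → isInvolutionᵇ v ≡ true
  to inv-w = allᵇ-applyUpTo⁺ _ id (length v) λ q q<|v| →
    trans (sym (proj₂ (along-e q q<|v|))) (allᵇ-applyUpTo⁻ _ id (length w) inv-w (e q) (proj₁ (along-e q q<|v|)))
  from : isInvolutionᵇ v ≡ true → isInvolutionᵇ w ≡ true
  from inv-v = allᵇ-applyUpTo⁺ _ id (length w) λ p p<|w| → case outside-e p p<|w| of λ where
    (inj₁ fixed) → fixed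
    (inj₂ (q , q<|v| , refl)) → trans (proj₂ (along-e q q<|v|)) (allᵇ-applyUpTo⁻ _ id (length v) inv-v q q<|v|)

indInvolution : Word → ℕ
indInvolution w = if distinctᵇ w then ind (isInvolutionᵇ w) else 0

numInv : ℕ → ℕ
numInv m = ∑Words m indInvolution

numInvolutions≡numInv : ∀ m → numInvolutions m ≡ numInv m
numInvolutions≡numInv m =
  trans (length≡∑1 (filter (λ w → isInvolutionᵇ w Boolₚ.≟ true) (perms m)))
  (trans (∑-filter isInvolutionᵇ (perms m) (λ _ → 1))
  (trans (∑-filter distinctᵇ (words m m) (λ w → ind (isInvolutionᵇ w)))
         (cong (λ ws → ∑ ws indInvolution) (words≡wordsOver m m))))

isInvolutionᵇ-0∷map-suc : ∀ u → All (_< length u) u → isInvolutionᵇ (0 ∷ map suc u) ≡ isInvolutionᵇ u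
isInvolutionᵇ-0∷map-suc u u<|u| = isInvolutionᵇ-transfer (0 ∷ map suc u) u suc along-suc outside-suc
  where
  |map-suc-u| = Listₚ.length-map suc u
  along-suc : ∀ q → q < length u →
              suc q < suc (length (map suc u)) × fixedByTwiceᵇ (0 ∷ map suc u) (suc q) ≡ fixedByTwiceᵇ u q
  along-suc q q<|u|
    rewrite lookupℕ-map suc u q q<|u| | lookupℕ-map suc u (lookupℕ u q) (lookupℕ-All u q u<|u| q<|u|) =
    s≤s (subst (q <_) (sym |map-suc-u|) q<|u|) , refl
  outside-suc : ∀ p → p < suc (length (map suc u)) →
                fixedByTwiceᵇ (0 ∷ map suc u) p ≡ true ⊎ ∃[ q ] (q < length u × suc q ≡ p)
  outside-suc zero _ = inj₁ refl
  outside-suc (suc q) (s≤s q<|u|) = inj₂ (q , subst (q <_) |map-suc-u| q<|u| , refl)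

-- An involution w with w 0 = suc i has w (suc i) = 0.
isInvolutionᵇ-suc∷ : ∀ i α c β → length α ≡ i → isInvolutionᵇ (suc i ∷ α ++ suc c ∷ β) ≡ false
isInvolutionᵇ-suc∷ i α c β refl rewrite lookupℕ-middle α (suc c) β = refl

-- Inserting the transposition (0 suc i) into a permutation v = α ++ β of size k, |α| = i:
-- the result suc i ∷ raise i α ++ 0 ∷ raise i β is a permutation, resp. an involution, iff v is.
module InsertTransposition (i k : ℕ) (α β : Word) (|α|≡i : length α ≡ i) (|v|≡k : length (α ++ β) ≡ k)
                           (v<k : All (_< k) (α ++ β)) where

  v w : Word
  v = α ++ β
  w = suc i ∷ raise i α ++ 0 ∷ raise i β

  length-raise : ∀ xs → length (raise i xs) ≡ length xs
  length-raise xs = trans (Listₚ.length-map suc (map (skip i) xs)) (Listₚ.length-map (skip i) xs)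

  |α|+|β|≡k : length α + length β ≡ k
  |α|+|β|≡k = trans (sym (Listₚ.length-++ α)) |v|≡k

  i≤k : i ≤ k
  i≤k = subst₂ _≤_ |α|≡i |α|+|β|≡k (m≤m+n (length α) (length β))

  |w|≡k+2 : length w ≡ suc (suc k)
  |w|≡k+2 = cong suc (trans (Listₚ.length-++ (raise i α))
    (trans (cong₂ _+_ (length-raise α) (cong suc (length-raise β))) (trans (+-suc _ _) (cong suc |α|+|β|≡k))))

  lookup-raise : ∀ xs t → t < length xs → lookupℕ (raise i xs) t ≡ suc (skip i (lookupℕ xs t))
  lookup-raise xs t t<|xs| =
    trans (lookupℕ-map suc (map (skip i) xs) t (subst (t <_) (sym (Listₚ.length-map (skip i) xs)) t<|xs|))
          (cong suc (lookupℕ-map (skip i) xs t t<|xs|))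

  lookup-w-suc-i : lookupℕ w (suc i) ≡ 0
  lookup-w-suc-i = subst (λ n → lookupℕ (raise i α ++ 0 ∷ raise i β) n ≡ 0) (trans (length-raise α) |α|≡i)
                         (lookupℕ-middle (raise i α) 0 (raise i β))

  lookup-w-skip : ∀ q → q < k → lookupℕ w (suc (skip i q)) ≡ suc (skip i (lookupℕ v q))
  lookup-w-skip q q<k with q <ᵇ i in q<ᵇi
  ... | true =
    trans (lookupℕ-++ˡ (raise i α) (0 ∷ raise i β) q (subst (q <_) (sym (length-raise α)) q<|α|))
          (trans (lookup-raise α q q<|α|) (cong (suc ∘ skip i) (sym (lookupℕ-++ˡ α β q q<|α|))))
    where q<|α| = subst (q <_) (sym |α|≡i) (<ᵇ≡true⇒< q i q<ᵇi)
  ... | false =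
    trans (cong (lookupℕ (raise i α ++ 0 ∷ raise i β)) q+1≡|raise-α|+t+1)
    (trans (lookupℕ-++ʳ (raise i α) (0 ∷ raise i β) (suc t))
    (trans (lookup-raise β t t<|β|)
           (cong (suc ∘ skip i) (sym (trans (cong (lookupℕ v) q≡|α|+t) (lookupℕ-++ʳ α β t))))))
    where
    t = q ∸ i
    i+t≡q : i + t ≡ q
    i+t≡q = m+[n∸m]≡n (<ᵇ≡false⇒≥ q i q<ᵇi)
    q+1≡|raise-α|+t+1 : suc q ≡ length (raise i α) + suc t
    q+1≡|raise-α|+t+1 =
      trans (cong suc (sym i+t≡q)) (trans (sym (+-suc i t)) (cong (_+ suc t) (sym (trans (length-raise α) |α|≡i))))
    q≡|α|+t : q ≡ length α + t
    q≡|α|+t = trans (sym i+t≡q) (cong (_+ t) (sym |α|≡i))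
    t<|β| : t < length β
    t<|β| = +-cancelˡ-< (length α) t (length β) (subst₂ _<_ q≡|α|+t (sym |α|+|β|≡k) q<k)

  skip-< : ∀ q → q < k → skip i q < suc k
  skip-< q q<k with q <ᵇ i
  ... | true = m≤n⇒m≤1+n q<k
  ... | false = s≤s q<k

  fixedByTwice-skip : ∀ q → q < k → fixedByTwiceᵇ w (suc (skip i q)) ≡ fixedByTwiceᵇ v q
  fixedByTwice-skip q q<k
    rewrite lookup-w-skip q q<k | lookup-w-skip (lookupℕ v q) (lookupℕ-All v q v<k (subst (q <_) (sym |v|≡k) q<k)) =
    ≡ᵇ-preserved (skip i) (skip-preservesOrder i) (lookupℕ v (lookupℕ v q)) q

  w-involutive : isInvolutionᵇ w ≡ isInvolutionᵇ v
  w-involutive = isInvolutionᵇ-transfer w v (suc ∘ skip i) along outside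
    where
    along : ∀ q → q < length v →
            suc (skip i q) < length w × fixedByTwiceᵇ w (suc (skip i q)) ≡ fixedByTwiceᵇ v q
    along q q<|v| = subst (suc (skip i q) <_) (sym |w|≡k+2) (s≤s (skip-< q q<k)) , fixedByTwice-skip q q<k
      where q<k = subst (q <_) |v|≡k q<|v|
    outside : ∀ p → p < length w → fixedByTwiceᵇ w p ≡ true ⊎ ∃[ q ] (q < length v × suc (skip i q) ≡ p)
    outside zero _ rewrite lookup-w-suc-i = inj₁ refl
    outside (suc p) p+1<|w| with p ≟ i
    ... | yes refl rewrite lookup-w-suc-i = inj₁ (≡ᵇ-refl i)
    ... | no p≢i with skip-onto i k p i≤k (≤-pred (subst (suc p <_) |w|≡k+2 p+1<|w|)) p≢i
    ...   | q , q<k , refl = inj₂ (q , subst (q <_) (sym |v|≡k) q<k , refl)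

  w-distinct : distinctᵇ w ≡ distinctᵇ v
  w-distinct
    rewrite elemᵇ-++ (suc i) (raise i α) (0 ∷ raise i β)
          | elemᵇ-map suc suc-preservesOrder i (map (skip i) α) | elemᵇ-map suc suc-preservesOrder i (map (skip i) β)
          | elemᵇ-skip i α | elemᵇ-skip i β | distinctᵇ-middle (raise i α) 0 (raise i β)
          | elemᵇ-0-map-suc (map (skip i) α) | elemᵇ-0-map-suc (map (skip i) β)
          | sym (Listₚ.map-++ suc (map (skip i) α) (map (skip i) β)) | sym (Listₚ.map-++ (skip i) α β)
          | distinctᵇ-map suc suc-preservesOrder (map (skip i) (α ++ β))
          | distinctᵇ-map (skip i) (skip-preservesOrder i) (α ++ β) = refl

  w-indInvolution : indInvolution w ≡ indInvolution v
  w-indInvolution rewrite w-distinct | w-involutive = refl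

indInvolution-suc∷ : ∀ i α β → indInvolution (suc i ∷ α ++ 0 ∷ β) ≡
  (if elemᵇ 0 α then 0 else (if elemᵇ (suc i) α then 0 else
  (if elemᵇ 0 β then 0 else (if elemᵇ (suc i) β then 0 else indInvolution (suc i ∷ α ++ 0 ∷ β)))))
indInvolution-suc∷ i α β rewrite elemᵇ-++ (suc i) α (0 ∷ β) | distinctᵇ-middle α 0 β =
  guards (elemᵇ 0 α) (elemᵇ (suc i) α) (elemᵇ 0 β) (elemᵇ (suc i) β)
         (distinctᵇ (α ++ β)) (ind (isInvolutionᵇ (suc i ∷ α ++ 0 ∷ β)))
  where
  guards : ∀ a b c d r (x : ℕ) → let lhs = if not (b ∨ d) ∧ (not (a ∨ c) ∧ r) then x else 0 in
           lhs ≡ (if a then 0 else (if b then 0 else (if c then 0 else (if d then 0 else lhs))))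
  guards true b c d r x = cong (λ t → if t then x else 0) (Boolₚ.∧-zeroʳ (not (b ∨ d)))
  guards false true c d r x = refl
  guards false false true d r x = cong (λ t → if t then x else 0) (Boolₚ.∧-zeroʳ (not d))
  guards false false false true r x = refl
  guards false false false false r x = refl

module InvolutionRecurrence (k : ℕ) where
  open ≡-Reasoning

  private
    [k+2] [k+1] [k] : List ℕ
    [k+2] = upTo (suc (suc k))
    [k+1] = upTo (suc k)
    [k] = upTo k

  first-letter-0 : ∑[ w ∈ wordsOver [k+2] (suc k) ] indInvolution (0 ∷ w) ≡ numInv (suc k)
  first-letter-0 = begin
    ∑[ w ∈ wordsOver [k+2] (suc k) ] indInvolution (0 ∷ w)
      ≡⟨ ∑-cong (wordsOver [k+2] (suc k)) 0∉ ⟩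
    ∑[ w ∈ wordsOver [k+2] (suc k) ] (if elemᵇ 0 w then 0 else tail-ind w)
      ≡⟨ ∑-wordsOver-remove 0 [k+2] (suc k) tail-ind ⟩
    ∑ (wordsOver (remove 0 [k+2]) (suc k)) tail-ind
      ≡⟨ cong (λ as → ∑ (wordsOver as (suc k)) tail-ind) (remove-0-upTo (suc k)) ⟩
    ∑ (wordsOver (map suc [k+1]) (suc k)) tail-ind
      ≡⟨ ∑-wordsOver-map suc [k+1] (suc k) tail-ind ⟩
    ∑[ u ∈ wordsOver [k+1] (suc k) ] tail-ind (map suc u)
      ≡⟨ ∑-wordsOver-upTo-cong (suc k) (suc k) standardised ⟩
    numInv (suc k) ∎
    where
    tail-ind : Word → ℕ
    tail-ind w = if distinctᵇ w then ind (isInvolutionᵇ (0 ∷ w)) else 0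
    0∉ : ∀ w → indInvolution (0 ∷ w) ≡ (if elemᵇ 0 w then 0 else tail-ind w)
    0∉ w with elemᵇ 0 w
    ... | true = refl
    ... | false = refl
    standardised : ∀ u → All (_< suc k) u → length u ≡ suc k → tail-ind (map suc u) ≡ indInvolution u
    standardised u u<k+1 |u|≡k+1
      rewrite distinctᵇ-map suc suc-preservesOrder u
            | isInvolutionᵇ-0∷map-suc u (subst (λ n → All (_< n) u) (sym |u|≡k+1) u<k+1) = refl

  first-letter-suc : ∀ i → i ≤ k → ∑[ w ∈ wordsOver [k+2] (suc k) ] indInvolution (suc i ∷ w) ≡ numInv k
  first-letter-suc i i≤k = begin
    ∑[ w ∈ wordsOver [k+2] (suc k) ] indInvolution (suc i ∷ w)
      ≡⟨ cong (λ n → ∑[ w ∈ wordsOver [k+2] n ] indInvolution (suc i ∷ w)) k+1≡i+[r+1] ⟩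
    ∑[ w ∈ wordsOver [k+2] (i + suc r) ] indInvolution (suc i ∷ w)
      ≡⟨ ∑-wordsOver-+ [k+2] i (suc r) _ ⟩
    ∑[ α ∈ wordsOver [k+2] i ] ∑[ β′ ∈ wordsOver [k+2] (suc r) ] indInvolution (suc i ∷ α ++ β′)
      ≡⟨ ∑-wordsOver-upTo-cong (suc (suc k)) i (λ α _ |α|≡i → zero-at-suc-i α |α|≡i) ⟩
    ∑[ α ∈ wordsOver [k+2] i ] ∑[ β ∈ wordsOver [k+2] r ] indInvolution (suc i ∷ α ++ 0 ∷ β)
      ≡⟨ ∑-cong (wordsOver [k+2] i) guarded ⟩
    ∑[ α ∈ wordsOver [k+2] i ] (if elemᵇ 0 α then 0 else (if elemᵇ (suc i) α then 0 else
      ∑[ β ∈ wordsOver [k+2] r ]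
        (if elemᵇ 0 β then 0 else (if elemᵇ (suc i) β then 0 else indInvolution (suc i ∷ α ++ 0 ∷ β)))))
      ≡⟨ ∑-wordsOver-remove-0-suc k i i _ i≤k ⟩
    ∑[ α ∈ wordsOver [k] i ] ∑[ β ∈ wordsOver [k+2] r ]
      (if elemᵇ 0 β then 0 else (if elemᵇ (suc i) β then 0 else indInvolution (suc i ∷ raise i α ++ 0 ∷ β)))
      ≡⟨ ∑-cong (wordsOver [k] i) (λ α → ∑-wordsOver-remove-0-suc k i r _ i≤k) ⟩
    ∑[ α ∈ wordsOver [k] i ] ∑[ β ∈ wordsOver [k] r ] indInvolution (suc i ∷ raise i α ++ 0 ∷ raise i β)
      ≡⟨ ∑-wordsOver-upTo-cong k i (λ α α<k |α|≡i → ∑-wordsOver-upTo-cong k r (λ β β<k |β|≡r →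
           InsertTransposition.w-indInvolution i k α β |α|≡i
             (trans (Listₚ.length-++ α) (trans (cong₂ _+_ |α|≡i |β|≡r) i+r≡k)) (All.++⁺ α<k β<k))) ⟩
    ∑[ α ∈ wordsOver [k] i ] ∑[ β ∈ wordsOver [k] r ] indInvolution (α ++ β)
      ≡⟨ ∑-wordsOver-+ [k] i r indInvolution ⟨
    ∑ (wordsOver [k] (i + r)) indInvolution
      ≡⟨ cong (λ n → ∑ (wordsOver [k] n) indInvolution) i+r≡k ⟩
    numInv k ∎
    where
    r = k ∸ i
    i+r≡k : i + r ≡ k
    i+r≡k = m+[n∸m]≡n i≤k
    k+1≡i+[r+1] : suc k ≡ i + suc r
    k+1≡i+[r+1] = trans (cong suc (sym i+r≡k)) (sym (+-suc i r))
    zero-at-suc-i : ∀ α → length α ≡ i →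
      ∑[ β′ ∈ wordsOver [k+2] (suc r) ] indInvolution (suc i ∷ α ++ β′)
      ≡ ∑[ β ∈ wordsOver [k+2] r ] indInvolution (suc i ∷ α ++ 0 ∷ β)
    zero-at-suc-i α |α|≡i = begin
      ∑[ β′ ∈ wordsOver [k+2] (suc r) ] indInvolution (suc i ∷ α ++ β′)
        ≡⟨ ∑-wordsOver-suc [k+2] r _ ⟩
      ∑[ c ∈ [k+2] ] ∑[ β ∈ wordsOver [k+2] r ] indInvolution (suc i ∷ α ++ c ∷ β)
        ≡⟨ ∑-upTo-suc (suc k) (λ c → ∑[ β ∈ wordsOver [k+2] r ] indInvolution (suc i ∷ α ++ c ∷ β)) ⟩
      ∑[ β ∈ wordsOver [k+2] r ] indInvolution (suc i ∷ α ++ 0 ∷ β)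
        + ∑[ c ∈ [k+1] ] ∑[ β ∈ wordsOver [k+2] r ] indInvolution (suc i ∷ α ++ suc c ∷ β)
        ≡⟨ cong (∑[ β ∈ wordsOver [k+2] r ] indInvolution (suc i ∷ α ++ 0 ∷ β) +_)
                (trans (∑-cong [k+1] λ c → trans (∑-cong (wordsOver [k+2] r) (notInvolution c)) (∑-zero (wordsOver [k+2] r)))
                       (∑-zero [k+1])) ⟩
      ∑[ β ∈ wordsOver [k+2] r ] indInvolution (suc i ∷ α ++ 0 ∷ β) + 0
        ≡⟨ +-identityʳ _ ⟩
      ∑[ β ∈ wordsOver [k+2] r ] indInvolution (suc i ∷ α ++ 0 ∷ β) ∎
      where
      notInvolution : ∀ c β → indInvolution (suc i ∷ α ++ suc c ∷ β) ≡ 0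
      notInvolution c β rewrite isInvolutionᵇ-suc∷ i α c β |α|≡i
        with distinctᵇ (suc i ∷ α ++ suc c ∷ β)
      ... | true = refl
      ... | false = refl
    guarded : ∀ α → ∑[ β ∈ wordsOver [k+2] r ] indInvolution (suc i ∷ α ++ 0 ∷ β)
      ≡ (if elemᵇ 0 α then 0 else (if elemᵇ (suc i) α then 0 else
         ∑[ β ∈ wordsOver [k+2] r ]
           (if elemᵇ 0 β then 0 else (if elemᵇ (suc i) β then 0 else indInvolution (suc i ∷ α ++ 0 ∷ β)))))
    guarded α =
      trans (∑-cong (wordsOver [k+2] r) (indInvolution-suc∷ i α))
      (trans (∑-if (wordsOver [k+2] r) (elemᵇ 0 α) _)
             (cong (λ z → if elemᵇ 0 α then 0 else z) (∑-if (wordsOver [k+2] r) (elemᵇ (suc i) α) _)))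

  numInv-rec : numInv (suc (suc k)) ≡ numInv (suc k) + suc k * numInv k
  numInv-rec = begin
    numInv (suc (suc k))
      ≡⟨ ∑-wordsOver-suc [k+2] (suc k) indInvolution ⟩
    ∑[ a ∈ [k+2] ] ∑[ w ∈ wordsOver [k+2] (suc k) ] indInvolution (a ∷ w)
      ≡⟨ ∑-upTo-suc (suc k) (λ a → ∑[ w ∈ wordsOver [k+2] (suc k) ] indInvolution (a ∷ w)) ⟩
    ∑[ w ∈ wordsOver [k+2] (suc k) ] indInvolution (0 ∷ w)
      + ∑[ i ∈ [k+1] ] ∑[ w ∈ wordsOver [k+2] (suc k) ] indInvolution (suc i ∷ w)
      ≡⟨ cong₂ _+_ first-letter-0 (∑-upTo-cong (suc k) (λ i i<k+1 → first-letter-suc i (≤-pred i<k+1))) ⟩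
    numInv (suc k) + ∑[ _ ∈ [k+1] ] numInv k
      ≡⟨ cong (numInv (suc k) +_) (∑-upTo-const (suc k) (numInv k)) ⟩
    numInv (suc k) + suc k * numInv k ∎

open InvolutionRecurrence using (numInv-rec)

numAv≡numInv : ∀ n → numAv n ≡ numInv n
numAv≡numInv n = proj₁ (both n)
  where
  both : ∀ n → numAv n ≡ numInv n × numAv (suc n) ≡ numInv (suc n)
  both zero = refl , refl
  both (suc n) with both n
  ... | eqₙ , eqₙ₊₁ =
    eqₙ₊₁ , trans (numAv-rec n) (trans (cong₂ (λ a b → a + suc n * b) eqₙ₊₁ eqₙ) (sym (numInv-rec n)))

mainTheorem5 : (count2314 4 ≡ 1) × (count2314 5 ≡ 4) ×
    ((n : ℕ) → n ≥ 6 →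
      count2314 n ≡ count2314 (n ∸ 1) + (n ∸ 1) * count2314 (n ∸ 2)
                    + ((n ∸ 2) C 2) * numInvolutions (n ∸ 4))
mainTheorem5 = refl , refl , recurrence
  where
  open ≡-Reasoning
  recurrence : (n : ℕ) → n ≥ 6 →
    count2314 n ≡ count2314 (n ∸ 1) + (n ∸ 1) * count2314 (n ∸ 2) + ((n ∸ 2) C 2) * numInvolutions (n ∸ 4)
  recurrence _ (s≤s (s≤s (s≤s (s≤s (s≤s (s≤s (z≤n {m}))))))) = begin
    count2314 (6 + m)
      ≡⟨ count2314≡total2314 (6 + m) ⟩
    total2314 (6 + m)
      ≡⟨ total2314-rec (4 + m) ⟩
    total2314 (5 + m) + (5 + m) * total2314 (4 + m) + newOccurrences (4 + m)
      ≡⟨ cong₂ (λ a b → a + (5 + m) * b + newOccurrences (4 + m))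
               (count2314≡total2314 (5 + m)) (count2314≡total2314 (4 + m)) ⟨
    count2314 (5 + m) + (5 + m) * count2314 (4 + m) + newOccurrences (4 + m)
      ≡⟨ cong (count2314 (5 + m) + (5 + m) * count2314 (4 + m) +_) (newOccurrences-rec (2 + m)) ⟩
    count2314 (5 + m) + (5 + m) * count2314 (4 + m) + ((4 + m) C 2) * numAv (2 + m)
      ≡⟨ cong (λ a → count2314 (5 + m) + (5 + m) * count2314 (4 + m) + ((4 + m) C 2) * a)
              (trans (numAv≡numInv (2 + m)) (sym (numInvolutions≡numInv (2 + m)))) ⟩
    count2314 (5 + m) + (5 + m) * count2314 (4 + m) + ((4 + m) C 2) * numInvolutions (2 + m) ∎
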